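{- Let $p$ be a prime, $h\ge 1$ an integer, $q=p^h$, and $k$ an integer with $1\le k\le q$. Let $\mathbf{P}_{q,k}$ be the $k\times q$ truncated Pascal matrix over $\mathbb{F}_q$ (defined in the context). Then any $k$ distinct columns of $\mathbf{P}_{q,k}$ are linearly independent over $\mathbb{F}_q$.
   Context: Realize $\mathbb{F}_q$ as $\mathbb{F}_p[x]/(g(x))$ for an irreducible polynomial $g$ of degree $h$, so each element is uniquely represented as a polynomial $\sum_{i=0}^{h-1}\beta_i x^i$ with $\beta_i\in\{0,1,\dots,p-1\}$. For an integer $n\in[0,q-1]$, let $\sigma(n)$ be the element of $\mathbb{F}_q$ whose coefficients satisfy $\sum_{i=0}^{h-1}\beta_i p^i=n$ (so $\sigma$ is a bijection from $\{0,\dots,q-1\}$ to $\mathbb{F}_q$). For integers $m,n\in[0,q-1]$ define $f_0(n)=1$ and, for $m>0$, $f_m(n)=\prod_{i=1}^{m}\frac{\sigma(n)-\sigma(i-1)}{\sigma(i)}$ (computed in $\mathbb{F}_q$). The Pascal matrix $\mathbf{P}_q$ is the $q\times q$ matrix over $\mathbb{F}_q$ with entries $\mathbf{P}_q(m,n)=f_m(n)$, $m,n\in\{0,\dots,q-1\}$ (indices from $0$). The truncated Pascal matrix $\mathbf{P}_{q,k}$ consists of the first $k$ rows of $\mathbf{P}_q$. -}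

module Defs where

open import Data.Nat using (ℕ; zero; suc; _+_; _*_; _∸_; _^_; _%_; _/_; NonZero; _≤_)
import Data.Fin
open import Data.Fin using (Fin; fromℕ; inject₁)
open import Data.List as L using (List; []; _∷_; length)
open import Data.Vec as V using (Vec; []; _∷_; lookup; toList)
open import Data.Product using (_×_; _,_)
open import Relation.Binary.PropositionalEquality using (_≡_; _≢_)

-- Arithmetic in F_p, elements represented by naturals (canonical rep < p).

module Fp (p : ℕ) .{{_ : NonZero p}} where

  _+p_ : ℕ → ℕ → ℕ
  a +p b = (a + b) % p

  _*p_ : ℕ → ℕ → ℕ
  a *p b = (a * b) % p

  -p_ : ℕ → ℕ
  -p a = (p ∸ (a % p)) % p

  -- inverse in F_p (p prime) via Fermat: a^(p-2)
  invp : ℕ → ℕ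
  invp a = (a ^ (p ∸ 2)) % p

  -- Polynomials over F_p as coefficient lists (lowest degree first).

  stripZeros : List ℕ → List ℕ
  stripZeros [] = []
  stripZeros (a ∷ as) with stripZeros as
  ... | [] with a
  ...   | zero  = []
  ...   | suc b = suc b ∷ []
  stripZeros (a ∷ as) | r ∷ rs = a ∷ r ∷ rs

  normP : List ℕ → List ℕ
  normP f = stripZeros (L.map (_% p) f)

  -- polynomial addition / multiplication (over ℕ; reduce with normP)
  addP : List ℕ → List ℕ → List ℕ
  addP [] g = g
  addP f [] = f
  addP (a ∷ f) (b ∷ g) = (a + b) ∷ addP f g

  mulP : List ℕ → List ℕ → List ℕ
  mulP [] g = []
  mulP (a ∷ f) g = addP (L.map (a *_) g) (0 ∷ mulP f g)

  Irreducible : List ℕ → Set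
  Irreducible g =
    (2 ≤ length (normP g)) ×
    (∀ (a b : List ℕ) → 2 ≤ length (normP a) → 2 ≤ length (normP b) →
       normP (mulP a b) ≢ normP g)

-- F_q = F_p[x]/(g), g = g_0 + g_1 x + ... + g_h x^h with g_h ≠ 0 (mod p).
-- Elements: Vec ℕ h of coefficients β_0 .. β_{h-1} (canonical: each < p).

module GF (p : ℕ) .{{_ : NonZero p}} {h : ℕ} (g : Vec ℕ (suc h)) where

  open Fp p

  Elem : Set
  Elem = Vec ℕ h

  lcInv : ℕ
  lcInv = invp (lookup g (fromℕ h))

  zeroQ : Elem
  zeroQ = V.replicate h 0

  oneQ : Elem
  oneQ = V.map (_% p) (V.tabulate (λ i → if-zero (Data.Fin.toℕ i)))
    where
      if-zero : ℕ → ℕ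
      if-zero zero = 1
      if-zero (suc _) = 0

  _+q_ : Elem → Elem → Elem
  a +q b = V.zipWith _+p_ a b

  -q_ : Elem → Elem
  -q a = V.map -p_ a

  _-q_ : Elem → Elem → Elem
  a -q b = a +q (-q b)

  push : {n : ℕ} → ℕ → Vec ℕ n → Vec ℕ n × ℕ
  push x [] = [] , x
  push x (a ∷ as) with push a as
  ... | s , t = (x ∷ s) , t

  -- multiplication by x, reduced modulo g:
  -- x·r = s + t x^h  ≡  s - t g_h^{-1} (g_0 + ... + g_{h-1} x^{h-1})   (mod g)
  mulX : Elem → Elem
  mulX r with push 0 r
  ... | s , t = V.tabulate (λ i →
          V.lookup s i +p (-p ((t *p lcInv) *p lookup g (inject₁ i))))

  addConst : ℕ → Elem → Elem
  addConst a [] = []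
  addConst a (b ∷ bs) = (a +p b) ∷ bs

  -- reduction of a polynomial over F_p (coefficient list) modulo g (Horner)
  reduce : List ℕ → Elem
  reduce f = L.foldr (λ a r → addConst a (mulX r)) zeroQ f

  _*q_ : Elem → Elem → Elem
  a *q b = reduce (mulP (toList a) (toList b))

  _^q_ : Elem → ℕ → Elem
  a ^q zero = oneQ
  a ^q suc n = a *q (a ^q n)

  -- multiplicative inverse in F_q (q = p^h): a^(q-2)  (= a^{-1} for a ≠ 0)
  invq : Elem → Elem
  invq a = a ^q ((p ^ h) ∸ 2)

  _/q_ : Elem → Elem → Elem
  a /q b = a *q invq b

  -- σ(n): base-p digits of n as coefficients β_0..β_{h-1}
  digits : (m : ℕ) → ℕ → Vec ℕ m
  digits zero n = []
  digits (suc m) n = (n % p) ∷ digits m (n / p)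

  σ : ℕ → Elem
  σ n = digits h n

  f : ℕ → ℕ → Elem
  f zero n = oneQ
  f (suc m) n = f m n *q ((σ n -q σ m) /q σ (suc m))

  P : ℕ → ℕ → Elem
  P m n = f m n

  sumQ : {k : ℕ} → (Fin k → Elem) → Elem
  sumQ {zero} v = zeroQ
  sumQ {suc k} v = v Data.Fin.zero +q sumQ (λ j → v (Data.Fin.suc j))

-- Over a field, entry (m, n) of P_q is N_m(σ n) for the Newton basis
-- N_m(x) = ∏_{i<m} (x - σ i) / σ (i + 1). Given a combination Σ_j a_j N_m(x_j) of k columns that vanishes
-- for all m < k, the coefficients a_j (x_j - x_0), j ≥ 1, give a vanishing combination of k - 1 columns for
-- all m < k - 1, because x - x_0 = (x - σ m) + (σ m - x_0) and (x - σ m) N_m(x) / σ (m + 1) = N_{m+1}(x).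
-- Induction on k and the absence of zero divisors make all a_j vanish.
--
-- Most of the work is showing that the concrete representation of F_q = F_p[x]/(g) is an integral domain:
-- its elements and operations realise the quotient of F_p[x] by the monic associate ĝ of g (mulX reduces
-- modulo ĝ, and reduce is Horner's rule), and Euclid's algorithm against the irreducible ĝ rules out zero
-- divisors. Inverses modulo p come from Fermat's little theorem, itself a consequence of p ∣ (p C k).

module Submission where

open import Defs
open import Data.Nat using (ℕ; suc; _^_; _≤_; _<_; _%_; NonZero)
open import Data.Nat.Primality using (Prime)
import Data.Fin
open import Data.Fin using (Fin; fromℕ)
open import Data.Vec using (Vec; toList; lookup)
open import Data.Vec.Relation.Unary.All using (All)
open import Function.Definitions using (Injective)
open import Relation.Binary.PropositionalEquality using (_≡_; _≢_)

open import Level using (0ℓ)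
open import Algebra.Bundles using (CommutativeRing; CommutativeSemiring)
open import Relation.Nullary using (¬_)
open import Data.Nat using (s≤s; z≤n)


module CommutativeRingFromLaws where

  open import Data.Product using (_,_)
  open import Relation.Binary.Structures using (IsEquivalence)

  record CommutativeRingLaws (A : Set) : Set₁ where
    field
      _≈_ : A → A → Set
      _+_ _*_ : A → A → A
      -_ : A → A
      0# 1# : A
      isEquivalence : IsEquivalence _≈_
      +-cong : ∀ {x x' y y'} → x ≈ x' → y ≈ y' → (x + y) ≈ (x' + y')
      *-cong : ∀ {x x' y y'} → x ≈ x' → y ≈ y' → (x * y) ≈ (x' * y')
      -‿cong : ∀ {x x'} → x ≈ x' → (- x) ≈ (- x')
      +-assoc : ∀ x y z → ((x + y) + z) ≈ (x + (y + z))
      +-comm : ∀ x y → (x + y) ≈ (y + x)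
      +-identityˡ : ∀ x → (0# + x) ≈ x
      -‿inverseˡ : ∀ x → ((- x) + x) ≈ 0#
      *-assoc : ∀ x y z → ((x * y) * z) ≈ (x * (y * z))
      *-comm : ∀ x y → (x * y) ≈ (y * x)
      *-identityˡ : ∀ x → (1# * x) ≈ x
      distribʳ : ∀ x y z → ((y + z) * x) ≈ ((y * x) + (z * x))

  commutativeRing : ∀ {A : Set} → CommutativeRingLaws A → CommutativeRing 0ℓ 0ℓ
  commutativeRing {A} laws = record
    { Carrier = A ; _≈_ = _≈_ ; _+_ = _+_ ; _*_ = _*_ ; -_ = -_ ; 0# = 0# ; 1# = 1#
    ; isCommutativeRing = record
      { isRing = record
        { +-isAbelianGroup = record
          { isGroup = record
            { isMonoid = record
              { isSemigroup = record
                { isMagma = record { isEquivalence = isEquivalence ; ∙-cong = +-cong }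
                ; assoc = +-assoc }
              ; identity = +-identityˡ , λ x → trans (+-comm x 0#) (+-identityˡ x) }
            ; inverse = -‿inverseˡ , λ x → trans (+-comm x (- x)) (-‿inverseˡ x)
            ; ⁻¹-cong = -‿cong }
          ; comm = +-comm }
        ; *-cong = *-cong
        ; *-assoc = *-assoc
        ; *-identity = *-identityˡ , λ x → trans (*-comm x 1#) (*-identityˡ x)
        ; distrib = (λ x y z → trans (*-comm x (y + z))
                                 (trans (distribʳ x y z) (+-cong (*-comm y x) (*-comm z x))))
                  , distribʳ }
      ; *-comm = *-comm } }
    where
    open CommutativeRingLaws laws
    open IsEquivalence isEquivalence


module ModuloPrincipalIdeal (R : CommutativeRing 0ℓ 0ℓ) (G : CommutativeRing.Carrier R) where

  open CommutativeRing R
  open import Algebra.Properties.Ring ring using (-‿distribˡ-*)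
  open import Algebra.Properties.AbelianGroup +-abelianGroup using (⁻¹-∙-comm)
  open import Algebra.Solver.Ring.NaturalCoefficients.Default commutativeSemiring
  open import Relation.Binary.Reasoning.Setoid setoid
  open CommutativeRingFromLaws

  infix 4 _∼_
  record _∼_ (f f' : Carrier) : Set where
    constructor congruent
    field
      quotient : Carrier
      decomposition : f ≈ f' + quotient * G

  ≈⇒∼ : ∀ {f f'} → f ≈ f' → f ∼ f'
  ≈⇒∼ {f} {f'} f≈f' = congruent 0# (begin
    f            ≈⟨ f≈f' ⟩
    f'           ≈⟨ +-identityʳ f' ⟨
    f' + 0#      ≈⟨ +-congˡ (zeroˡ G) ⟨
    f' + 0# * G  ∎)

  multiple∼0 : ∀ Q → Q * G ∼ 0#
  multiple∼0 Q = congruent Q (sym (+-identityˡ _))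

  ∼-sym : ∀ {f f'} → f ∼ f' → f' ∼ f
  ∼-sym {f} {f'} (congruent Q f≈) = congruent (- Q) (begin
    f'                         ≈⟨ +-identityʳ f' ⟨
    f' + 0#                    ≈⟨ +-congˡ (zeroˡ G) ⟨
    f' + 0# * G                ≈⟨ +-congˡ (*-congʳ (-‿inverseʳ Q)) ⟨
    f' + (Q - Q) * G           ≈⟨ +-congˡ (distribʳ G Q (- Q)) ⟩
    f' + (Q * G + (- Q) * G)   ≈⟨ +-assoc f' (Q * G) ((- Q) * G) ⟨
    (f' + Q * G) + (- Q) * G   ≈⟨ +-congʳ f≈ ⟨
    f + (- Q) * G              ∎)

  ∼-trans : ∀ {f f' f''} → f ∼ f' → f' ∼ f'' → f ∼ f''
  ∼-trans {f} {f'} {f''} (congruent Q f≈) (congruent Q' f'≈) = congruent (Q' + Q) (begin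
    f                          ≈⟨ f≈ ⟩
    f' + Q * G                 ≈⟨ +-congʳ f'≈ ⟩
    (f'' + Q' * G) + Q * G     ≈⟨ solve 4 (λ a r q g → (a :+ r :* g) :+ q :* g := a :+ (r :+ q) :* g)
                                        refl f'' Q' Q G ⟩
    f'' + (Q' + Q) * G         ∎)

  ∼-+ : ∀ {f f' g g'} → f ∼ f' → g ∼ g' → f + g ∼ f' + g'
  ∼-+ {f} {f'} {g} {g'} (congruent Q f≈) (congruent Q' g≈) = congruent (Q + Q') (begin
    f + g                          ≈⟨ +-cong f≈ g≈ ⟩
    (f' + Q * G) + (g' + Q' * G)   ≈⟨ solve 5 (λ a b q r x → (a :+ q :* x) :+ (b :+ r :* x)
                                                   := (a :+ b) :+ (q :+ r) :* x)
                                            refl f' g' Q Q' G ⟩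
    (f' + g') + (Q + Q') * G       ∎)

  ∼-* : ∀ {f f' g g'} → f ∼ f' → g ∼ g' → f * g ∼ f' * g'
  ∼-* {f} {f'} {g} {g'} (congruent Q f≈) (congruent Q' g≈) = congruent (Q * g' + f' * Q' + Q * Q' * G) (begin
    f * g                                       ≈⟨ *-cong f≈ g≈ ⟩
    (f' + Q * G) * (g' + Q' * G)                ≈⟨ solve 5 (λ a b q r x → (a :+ q :* x) :* (b :+ r :* x)
                                                     := a :* b :+ (q :* b :+ a :* r :+ q :* r :* x) :* x)
                                                     refl f' g' Q Q' G ⟩
    f' * g' + (Q * g' + f' * Q' + Q * Q' * G) * G ∎)

  ∼-neg : ∀ {f f'} → f ∼ f' → - f ∼ - f'
  ∼-neg {f} {f'} (congruent Q f≈) = congruent (- Q) (begin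
    - f                  ≈⟨ -‿cong f≈ ⟩
    - (f' + Q * G)       ≈⟨ ⁻¹-∙-comm f' (Q * G) ⟨
    - f' + - (Q * G)     ≈⟨ +-congˡ (-‿distribˡ-* Q G) ⟩
    - f' + (- Q) * G     ∎)

  quotientRing : CommutativeRing 0ℓ 0ℓ
  quotientRing = commutativeRing record
    { _≈_ = _∼_ ; _+_ = _+_ ; _*_ = _*_ ; -_ = -_ ; 0# = 0# ; 1# = 1#
    ; isEquivalence = record { refl = ≈⇒∼ refl ; sym = ∼-sym ; trans = ∼-trans }
    ; +-cong = ∼-+ ; *-cong = ∼-* ; -‿cong = ∼-neg
    ; +-assoc = λ x y z → ≈⇒∼ (+-assoc x y z)
    ; +-comm = λ x y → ≈⇒∼ (+-comm x y)
    ; +-identityˡ = λ x → ≈⇒∼ (+-identityˡ x)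
    ; -‿inverseˡ = λ x → ≈⇒∼ (-‿inverseˡ x)
    ; *-assoc = λ x y z → ≈⇒∼ (*-assoc x y z)
    ; *-comm = λ x y → ≈⇒∼ (*-comm x y)
    ; *-identityˡ = λ x → ≈⇒∼ (*-identityˡ x)
    ; distribʳ = λ x y z → ≈⇒∼ (distribʳ x y z) }


module Pullback (S : CommutativeRing 0ℓ 0ℓ) {E : Set} (ι : E → CommutativeRing.Carrier S)
  (_⊕_ _⊛_ : E → E → E) (⊝_ : E → E) (𝟘 𝟙 : E) where

  open CommutativeRing S
  open import Relation.Binary.Reasoning.Setoid setoid
  open CommutativeRingFromLaws

  infix 4 _≈ᴱ_
  record _≈ᴱ_ (a b : E) : Set where
    constructor by-ι
    field ι-≈ : ι a ≈ ι b
  open _≈ᴱ_ public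

  module _ (ι-+ : ∀ a b → ι (a ⊕ b) ≈ ι a + ι b) (ι-* : ∀ a b → ι (a ⊛ b) ≈ ι a * ι b)
           (ι-neg : ∀ a → ι (⊝ a) ≈ - ι a) (ι-0 : ι 𝟘 ≈ 0#) (ι-1 : ι 𝟙 ≈ 1#) where

    pullbackRing : CommutativeRing 0ℓ 0ℓ
    pullbackRing = commutativeRing record
      { _≈_ = _≈ᴱ_ ; _+_ = _⊕_ ; _*_ = _⊛_ ; -_ = ⊝_ ; 0# = 𝟘 ; 1# = 𝟙
      ; isEquivalence = record { refl = by-ι refl ; sym = λ e → by-ι (sym (ι-≈ e))
                               ; trans = λ e e' → by-ι (trans (ι-≈ e) (ι-≈ e')) }
      ; +-cong = λ {a} {a'} {b} {b'} e e' → by-ι (begin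
          ι (a ⊕ b)      ≈⟨ ι-+ a b ⟩
          ι a + ι b      ≈⟨ +-cong (ι-≈ e) (ι-≈ e') ⟩
          ι a' + ι b'    ≈⟨ ι-+ a' b' ⟨
          ι (a' ⊕ b')    ∎)
      ; *-cong = λ {a} {a'} {b} {b'} e e' → by-ι (begin
          ι (a ⊛ b)      ≈⟨ ι-* a b ⟩
          ι a * ι b      ≈⟨ *-cong (ι-≈ e) (ι-≈ e') ⟩
          ι a' * ι b'    ≈⟨ ι-* a' b' ⟨
          ι (a' ⊛ b')    ∎)
      ; -‿cong = λ {a} {a'} e → by-ι (begin
          ι (⊝ a)        ≈⟨ ι-neg a ⟩
          - ι a          ≈⟨ -‿cong (ι-≈ e) ⟩
          - ι a'         ≈⟨ ι-neg a' ⟨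
          ι (⊝ a')       ∎)
      ; +-assoc = λ a b c → by-ι (begin
          ι ((a ⊕ b) ⊕ c)       ≈⟨ trans (ι-+ (a ⊕ b) c) (+-congʳ (ι-+ a b)) ⟩
          (ι a + ι b) + ι c     ≈⟨ +-assoc (ι a) (ι b) (ι c) ⟩
          ι a + (ι b + ι c)     ≈⟨ trans (ι-+ a (b ⊕ c)) (+-congˡ (ι-+ b c)) ⟨
          ι (a ⊕ (b ⊕ c))       ∎)
      ; +-comm = λ a b → by-ι (begin
          ι (a ⊕ b)      ≈⟨ ι-+ a b ⟩
          ι a + ι b      ≈⟨ +-comm (ι a) (ι b) ⟩
          ι b + ι a      ≈⟨ ι-+ b a ⟨
          ι (b ⊕ a)      ∎)
      ; +-identityˡ = λ a → by-ι (begin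
          ι (𝟘 ⊕ a)      ≈⟨ trans (ι-+ 𝟘 a) (+-congʳ ι-0) ⟩
          0# + ι a       ≈⟨ +-identityˡ (ι a) ⟩
          ι a            ∎)
      ; -‿inverseˡ = λ a → by-ι (begin
          ι ((⊝ a) ⊕ a)  ≈⟨ trans (ι-+ (⊝ a) a) (+-congʳ (ι-neg a)) ⟩
          - ι a + ι a    ≈⟨ -‿inverseˡ (ι a) ⟩
          0#             ≈⟨ ι-0 ⟨
          ι 𝟘            ∎)
      ; *-assoc = λ a b c → by-ι (begin
          ι ((a ⊛ b) ⊛ c)       ≈⟨ trans (ι-* (a ⊛ b) c) (*-congʳ (ι-* a b)) ⟩
          (ι a * ι b) * ι c     ≈⟨ *-assoc (ι a) (ι b) (ι c) ⟩
          ι a * (ι b * ι c)     ≈⟨ trans (ι-* a (b ⊛ c)) (*-congˡ (ι-* b c)) ⟨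
          ι (a ⊛ (b ⊛ c))       ∎)
      ; *-comm = λ a b → by-ι (begin
          ι (a ⊛ b)      ≈⟨ ι-* a b ⟩
          ι a * ι b      ≈⟨ *-comm (ι a) (ι b) ⟩
          ι b * ι a      ≈⟨ ι-* b a ⟨
          ι (b ⊛ a)      ∎)
      ; *-identityˡ = λ a → by-ι (begin
          ι (𝟙 ⊛ a)      ≈⟨ trans (ι-* 𝟙 a) (*-congʳ ι-1) ⟩
          1# * ι a       ≈⟨ *-identityˡ (ι a) ⟩
          ι a            ∎)
      ; distribʳ = λ a b c → by-ι (begin
          ι ((b ⊕ c) ⊛ a)                ≈⟨ trans (ι-* (b ⊕ c) a) (*-congʳ (ι-+ b c)) ⟩
          (ι b + ι c) * ι a              ≈⟨ distribʳ (ι a) (ι b) (ι c) ⟩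
          ι b * ι a + ι c * ι a          ≈⟨ trans (ι-+ (b ⊛ a) (c ⊛ a)) (+-cong (ι-* b a) (ι-* c a)) ⟨
          ι ((b ⊛ a) ⊕ (c ⊛ a))          ∎) }


module IntegralDomain (R : CommutativeRing 0ℓ 0ℓ) where

  open CommutativeRing R hiding (zero)
  open import Data.Nat using (zero)
  open import Data.Sum using (_⊎_; inj₁; inj₂)
  open import Relation.Nullary using (¬_; contradiction)
  open import Algebra.Definitions _≈_ using (AlmostLeftCancellative)
  open import Algebra.Properties.Ring ring using (x[y-z]≈xy-xz)
  open import Algebra.Properties.Group +-group using (x∙y⁻¹≈ε⇒x≈y; x≈y⇒x∙y⁻¹≈ε)
  open import Algebra.Properties.Semiring.Exp semiring using () renaming (_^_ to _^ᴿ_)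

  NoZeroDivisors : Set
  NoZeroDivisors = ∀ x y → x * y ≈ 0# → x ≈ 0# ⊎ y ≈ 0#

  module _ (noZeroDivisors : NoZeroDivisors) where

    x*y≈0∧y≉0⇒x≈0 : ∀ {x y} → x * y ≈ 0# → ¬ y ≈ 0# → x ≈ 0#
    x*y≈0∧y≉0⇒x≈0 {x} {y} xy≈0 y≉0 with noZeroDivisors x y xy≈0
    ... | inj₁ x≈0 = x≈0
    ... | inj₂ y≈0 = contradiction y≈0 y≉0

    *-cancelˡ-nonzero : AlmostLeftCancellative 0# _*_
    *-cancelˡ-nonzero x y z x≉0 xy≈xz = x∙y⁻¹≈ε⇒x≈y y z
      (x*y≈0∧y≉0⇒x≈0 (trans (*-comm _ x) (trans (x[y-z]≈xy-xz x y z) (x≈y⇒x∙y⁻¹≈ε xy≈xz))) x≉0)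

    x≉0⇒x^n≉0 : ¬ 1# ≈ 0# → ∀ {x} n → ¬ x ≈ 0# → ¬ x ^ᴿ n ≈ 0#
    x≉0⇒x^n≉0 1≉0 zero x≉0 = 1≉0
    x≉0⇒x^n≉0 1≉0 {x} (suc n) x≉0 x^[1+n]≈0 =
      x≉0⇒x^n≉0 1≉0 n x≉0 (x*y≈0∧y≉0⇒x≈0 (trans (*-comm _ x) x^[1+n]≈0) x≉0)


module NewtonBasis (R : CommutativeRing 0ℓ 0ℓ) where

  open CommutativeRing R hiding (zero)
  open import Data.Nat using (zero; s≤s; z≤n)
  open import Data.Nat.Properties using (m<n⇒m<1+n)
  open import Data.Fin using (zero; suc)
  open import Data.Fin.Properties using (suc-injective)
  open import Function using (case_of_)
  open import Relation.Nullary using (¬_)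
  open import Algebra.Properties.Semiring.Sum semiring
    using (sum; sum-cong-≋; sum-replicate-zero; ∑-distrib-+; *-distribˡ-sum; *-distribʳ-sum)
  open import Algebra.Properties.Group +-group using (x∙y⁻¹≈ε⇒x≈y)
  open import Algebra.Solver.Ring.NaturalCoefficients.Default commutativeSemiring
  open import Relation.Binary.Reasoning.Setoid setoid
  open IntegralDomain R

  [x-s]+[s-y]≈x-y : ∀ x s y → (x - s) + (s - y) ≈ x - y
  [x-s]+[s-y]≈x-y x s y = begin
    (x - s) + (s - y)      ≈⟨ solve 4 (λ x s n m → (x :+ n) :+ (s :+ m) := (x :+ (n :+ s)) :+ m)
                                    refl x s (- s) (- y) ⟩
    (x + (- s + s)) - y    ≈⟨ +-congʳ (+-congˡ (-‿inverseˡ s)) ⟩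
    (x + 0#) - y           ≈⟨ +-congʳ (+-identityʳ x) ⟩
    x - y                  ∎

  module _ (s u : ℕ → Carrier) where

    -- Column j lists the values N_m(x_j) of the Newton basis N_m(x) = ∏_{i<m} (x - s i) u i at the node x_j.
    record NewtonColumns (k : ℕ) : Set where
      field
        node : Fin k → Carrier
        column : ℕ → Fin k → Carrier
        column-zero : ∀ j → column 0 j ≈ 1#
        column-suc : ∀ m j → column (suc m) j ≈ column m j * ((node j - s m) * u m)

    tail-columns : ∀ {k} → NewtonColumns (suc k) → NewtonColumns k
    tail-columns N = record
      { node = λ j → node (suc j)
      ; column = λ m j → column m (suc j)
      ; column-zero = λ j → column-zero (suc j)
      ; column-suc = λ m j → column-suc m (suc j) }
      where open NewtonColumns N

    module _ (noZeroDivisors : NoZeroDivisors) where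

      -- x_j - y = (x_j - s m) + (s m - y), and (x_j - s m) u m turns column m into column m + 1.
      twist-preserves-row≈0 : ∀ {k} (N : NewtonColumns k) → let open NewtonColumns N in
        ∀ (a : Fin k → Carrier) y m → ¬ u m ≈ 0#
        → sum (λ j → a j * column m j) ≈ 0#
        → sum (λ j → a j * column (suc m) j) ≈ 0#
        → sum (λ j → (a j * (node j - y)) * column m j) ≈ 0#
      twist-preserves-row≈0 N a y m uₘ≉0 rowₘ≈0 rowₘ₊₁≈0 = begin
        sum (λ j → (a j * (node j - y)) * column m j)  ≈⟨ sum-cong-≋ split ⟩
        sum (λ j → t j * d j + e * t j)               ≈⟨ ∑-distrib-+ (λ j → t j * d j) (λ j → e * t j) ⟩
        sum (λ j → t j * d j) + sum (λ j → e * t j)   ≈⟨ +-cong td≈0 (sym (*-distribˡ-sum e t)) ⟩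
        0# + e * sum t                                ≈⟨ +-identityˡ _ ⟩
        e * sum t                                     ≈⟨ *-congˡ rowₘ≈0 ⟩
        e * 0#                                        ≈⟨ zeroʳ e ⟩
        0#                                            ∎
        where
        open NewtonColumns N
        t d : Fin _ → Carrier
        t j = a j * column m j
        d j = node j - s m
        e : Carrier
        e = s m - y
        split : ∀ j → (a j * (node j - y)) * column m j ≈ t j * d j + e * t j
        split j = begin
          (a j * (node j - y)) * column m j   ≈⟨ *-congʳ (*-congˡ ([x-s]+[s-y]≈x-y (node j) (s m) y)) ⟨
          (a j * (d j + e)) * column m j      ≈⟨ solve 4 (λ a d e n → (a :* (d :+ e)) :* n := (a :* n) :* d :+ e :* (a :* n))
                                                   refl (a j) (d j) e (column m j) ⟩
          t j * d j + e * t j                 ∎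
        td≈0 : sum (λ j → t j * d j) ≈ 0#
        td≈0 = x*y≈0∧y≉0⇒x≈0 noZeroDivisors (begin
          sum (λ j → t j * d j) * u m                   ≈⟨ *-distribʳ-sum (u m) (λ j → t j * d j) ⟩
          sum (λ j → (t j * d j) * u m)                 ≈⟨ sum-cong-≋ (λ j → trans
                                                             (solve 4 (λ a n d u → ((a :* n) :* d) :* u := a :* (n :* (d :* u)))
                                                                    refl (a j) (column m j) (d j) (u m))
                                                             (*-congˡ (sym (column-suc m j)))) ⟩
          sum (λ j → a j * column (suc m) j)            ≈⟨ rowₘ₊₁≈0 ⟩
          0#                                            ∎) uₘ≉0

      newton-independent : ∀ {k} (N : NewtonColumns k) → let open NewtonColumns N in
        Injective _≡_ _≈_ node → (∀ m → suc m < k → ¬ u m ≈ 0#) →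
        (a : Fin k → Carrier) → (∀ m → m < k → sum (λ j → a j * column m j) ≈ 0#) →
        ∀ j → a j ≈ 0#
      newton-independent {suc k} N node-injective u≉0 a rows≈0 = coefficient≈0
        where
        open NewtonColumns N
        y : Carrier
        y = node zero
        b : Fin k → Carrier
        b j = a (suc j) * (node (suc j) - y)
        tail-rows≈0 : ∀ m → m < k → sum (λ j → b j * column m (suc j)) ≈ 0#
        tail-rows≈0 m m<k = begin
          sum (λ j → b j * column m (suc j))                    ≈⟨ +-identityˡ _ ⟨
          0# + sum (λ j → b j * column m (suc j))               ≈⟨ +-congʳ head≈0 ⟨
          sum (λ j → (a j * (node j - y)) * column m j)         ≈⟨ twist-preserves-row≈0 N a y m (u≉0 m (s≤s m<k))
                                                                     (rows≈0 m (m<n⇒m<1+n m<k)) (rows≈0 (suc m) (s≤s m<k)) ⟩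
          0#                                                    ∎
          where
          head≈0 : (a zero * (y - y)) * column m zero ≈ 0#
          head≈0 = trans (*-congʳ (trans (*-congˡ (-‿inverseʳ y)) (zeroʳ _))) (zeroˡ _)
        b≈0 : ∀ j → b j ≈ 0#
        b≈0 = newton-independent (tail-columns N) (λ e → suc-injective (node-injective e))
                (λ m 1+m<k → u≉0 m (m<n⇒m<1+n 1+m<k)) b tail-rows≈0
        tail≈0 : ∀ j → a (suc j) ≈ 0#
        tail≈0 j = x*y≈0∧y≉0⇒x≈0 noZeroDivisors (b≈0 j)
                     (λ d≈0 → case node-injective (x∙y⁻¹≈ε⇒x≈y _ _ d≈0) of λ ())
        head≈0 : a zero ≈ 0#
        head≈0 = begin
          a zero                                            ≈⟨ *-identityʳ _ ⟨
          a zero * 1#                                       ≈⟨ *-congˡ (column-zero zero) ⟨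
          a zero * column 0 zero                            ≈⟨ +-identityʳ _ ⟨
          a zero * column 0 zero + 0#                       ≈⟨ +-congˡ (sum-replicate-zero k) ⟨
          a zero * column 0 zero + sum {k} (λ _ → 0#)       ≈⟨ +-congˡ (sum-cong-≋ (λ j → trans (*-congʳ (tail≈0 j)) (zeroˡ _))) ⟨
          sum (λ j → a j * column 0 j)                      ≈⟨ rows≈0 0 (s≤s z≤n) ⟩
          0#                                                ∎
        coefficient≈0 : ∀ j → a j ≈ 0#
        coefficient≈0 zero = head≈0
        coefficient≈0 (suc j) = tail≈0 j


module BinomialWithVanishingMiddle (S : CommutativeSemiring 0ℓ 0ℓ) where

  open CommutativeSemiring S hiding (zero)
  open import Data.Nat using (zero; _∸_; s≤s; z≤n)
  open import Data.Nat.Properties using (n∸n≡0)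
  open import Data.Nat.Combinatorics using (_C_; nCn≡1)
  open import Data.Fin using (zero; suc; toℕ; inject₁)
  open import Data.Fin.Properties using (toℕ-inject₁; toℕ-fromℕ; toℕ<n)
  open import Relation.Binary.PropositionalEquality using (subst) renaming (sym to ≡-sym)
  open import Algebra.Properties.CommutativeSemiring.Binomial S using (binomialTerm; theorem)
  open import Algebra.Properties.Semiring.Sum semiring using (sum; sum-init-last; sum-cong-≋; sum-replicate-zero)
  open import Algebra.Properties.Semiring.Mult semiring using (_×_; ×-homo-1)
  open import Algebra.Properties.Semiring.Exp semiring using () renaming (_^_ to _^ᴿ_)
  open import Relation.Binary.Reasoning.Setoid setoid

  [x+y]^n≈y^n+x^n : ∀ n → (∀ k z → 0 < k → k < suc n → (suc n C k) × z ≈ 0#)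
    → ∀ x y → (x + y) ^ᴿ suc n ≈ y ^ᴿ suc n + x ^ᴿ suc n
  [x+y]^n≈y^n+x^n n middle≈0 x y = begin
    (x + y) ^ᴿ suc n                                  ≈⟨ theorem (suc n) x y ⟩
    T zero + sum (λ k → T (suc k))                    ≈⟨ +-congˡ (sum-init-last (λ k → T (suc k))) ⟩
    T zero + (sum (λ k → T (suc (inject₁ k))) + T (suc (fromℕ n)))
                                                      ≈⟨ +-congˡ (+-congʳ (trans (sum-cong-≋ inner≈0) (sum-replicate-zero n))) ⟩
    T zero + (0# + T (suc (fromℕ n)))                 ≈⟨ +-cong (trans (×-homo-1 _) (*-identityˡ _)) (+-identityˡ _) ⟩
    y ^ᴿ suc n + T (suc (fromℕ n))                    ≈⟨ +-congˡ last≈xⁿ ⟩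
    y ^ᴿ suc n + x ^ᴿ suc n                           ∎
    where
    T : Fin (suc (suc n)) → Carrier
    T = binomialTerm x y (suc n)
    inner≈0 : ∀ k → T (suc (inject₁ k)) ≈ 0#
    inner≈0 k = middle≈0 _ _ (s≤s z≤n) (s≤s (subst (_< n) (≡-sym (toℕ-inject₁ k)) (toℕ<n k)))
    last≈xⁿ : T (suc (fromℕ n)) ≈ x ^ᴿ suc n
    last≈xⁿ rewrite toℕ-fromℕ n | nCn≡1 (suc n) | n∸n≡0 n =
      trans (×-homo-1 _) (*-identityʳ _)


module Residues (p : ℕ) .{{_ : NonZero p}} where

  open import Data.Nat
  open import Data.Nat.Properties
  open import Data.Nat.DivMod
  open import Data.Nat.Divisibility using (_∣_; m%n≡0⇒n∣m; n∣m⇒m%n≡0; m∣m*n; >⇒∤; ∣1⇒≡1)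
  open import Data.Nat.Primality using (euclidsLemma; prime⇒nonTrivial)
  open import Data.Nat.Combinatorics using (_C_; nCk≡n!/k![n-k]!; k![n∸k]!∣n!)
  open import Data.Sum using (inj₁; inj₂; [_,_]′) renaming (map to ⊎-map)
  open import Data.Empty using (⊥-elim)
  open import Function using (_$_)
  open import Relation.Binary.PropositionalEquality
  open import Relation.Nullary using (¬_; Dec)
  open Fp p using (_+p_; _*p_; -p_)
  open CommutativeRingFromLaws

  infix 4 _≡ₘ_
  _≡ₘ_ : ℕ → ℕ → Set
  a ≡ₘ b = a % p ≡ b % p

  ≡⇒≡ₘ : ∀ {a b} → a ≡ b → a ≡ₘ b
  ≡⇒≡ₘ = cong (_% p)

  a%p≡ₘa : ∀ a → a % p ≡ₘ a
  a%p≡ₘa a = m%n%n≡m%n a p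

  0%p≡0 : 0 % p ≡ 0
  0%p≡0 = m<n⇒m%n≡m (>-nonZero⁻¹ p)

  <p∧≡ₘ0⇒≡0 : ∀ {a} → a < p → a ≡ₘ 0 → a ≡ 0
  <p∧≡ₘ0⇒≡0 a<p a≡ₘ0 = trans (sym (m<n⇒m%n≡m a<p)) (trans a≡ₘ0 0%p≡0)

  _≡ₘ?_ : ∀ a b → Dec (a ≡ₘ b)
  a ≡ₘ? b = a % p ≟ b % p

  ≡ₘ0⇒∣ : ∀ a → a ≡ₘ 0 → p ∣ a
  ≡ₘ0⇒∣ a a≡ₘ0 = m%n≡0⇒n∣m a p (trans a≡ₘ0 0%p≡0)

  ∣⇒≡ₘ0 : ∀ a → p ∣ a → a ≡ₘ 0
  ∣⇒≡ₘ0 a p∣a = trans (n∣m⇒m%n≡0 a p p∣a) (sym 0%p≡0)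

  +-congₘ : ∀ {a a' b b'} → a ≡ₘ a' → b ≡ₘ b' → a + b ≡ₘ a' + b'
  +-congₘ {a} {a'} {b} {b'} a≡a' b≡b' = begin
    (a + b) % p              ≡⟨ %-distribˡ-+ a b p ⟩
    (a % p + b % p) % p      ≡⟨ cong₂ (λ x y → (x + y) % p) a≡a' b≡b' ⟩
    (a' % p + b' % p) % p    ≡⟨ %-distribˡ-+ a' b' p ⟨
    (a' + b') % p            ∎
    where open ≡-Reasoning

  *-congₘ : ∀ {a a' b b'} → a ≡ₘ a' → b ≡ₘ b' → a * b ≡ₘ a' * b'
  *-congₘ {a} {a'} {b} {b'} a≡a' b≡b' = begin
    (a * b) % p              ≡⟨ %-distribˡ-* a b p ⟩
    (a % p * (b % p)) % p    ≡⟨ cong₂ (λ x y → (x * y) % p) a≡a' b≡b' ⟩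
    (a' % p * (b' % p)) % p  ≡⟨ %-distribˡ-* a' b' p ⟨
    (a' * b') % p            ∎
    where open ≡-Reasoning

  -ₘ_ : ℕ → ℕ
  -ₘ x = (p ∸ 1) * x

  -ₘx+x≡ₘ0 : ∀ x → -ₘ x + x ≡ₘ 0
  -ₘx+x≡ₘ0 x = begin
    ((p ∸ 1) * x + x) % p    ≡⟨ cong (_% p) (+-comm ((p ∸ 1) * x) x) ⟩
    (suc (p ∸ 1) * x) % p    ≡⟨ cong (λ n → (n * x) % p) (suc-pred p) ⟩
    (p * x) % p              ≡⟨ cong (_% p) (*-comm p x) ⟩
    (x * p) % p              ≡⟨ trans (m*n%n≡0 x p) (sym 0%p≡0) ⟩
    0 % p                    ∎
    where open ≡-Reasoning

  ℤ/p : CommutativeRing 0ℓ 0ℓ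
  ℤ/p = commutativeRing record
    { _≈_ = _≡ₘ_ ; _+_ = _+_ ; _*_ = _*_ ; -_ = -ₘ_ ; 0# = 0 ; 1# = 1
    ; isEquivalence = record { refl = refl ; sym = sym ; trans = trans }
    ; +-cong = +-congₘ ; *-cong = *-congₘ ; -‿cong = *-congₘ {p ∸ 1} refl
    ; +-assoc = λ x y z → ≡⇒≡ₘ (+-assoc x y z)
    ; +-comm = λ x y → ≡⇒≡ₘ (+-comm x y)
    ; +-identityˡ = λ x → refl
    ; -‿inverseˡ = -ₘx+x≡ₘ0
    ; *-assoc = λ x y z → ≡⇒≡ₘ (*-assoc x y z)
    ; *-comm = λ x y → ≡⇒≡ₘ (*-comm x y)
    ; *-identityˡ = λ x → ≡⇒≡ₘ (*-identityˡ x)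
    ; distribʳ = λ x y z → ≡⇒≡ₘ (*-distribʳ-+ x y z) }

  open import Algebra.Properties.Group (CommutativeRing.+-group ℤ/p) using (inverseˡ-unique)

  +p≡ₘ+ : ∀ a b → a +p b ≡ₘ a + b
  +p≡ₘ+ a b = a%p≡ₘa (a + b)

  *p≡ₘ* : ∀ a b → a *p b ≡ₘ a * b
  *p≡ₘ* a b = a%p≡ₘa (a * b)

  -p≡ₘ-ₘ : ∀ a → -p a ≡ₘ -ₘ a
  -p≡ₘ-ₘ a = inverseˡ-unique (-p a) a (begin
    (-p a + a) % p                ≡⟨ +-congₘ (a%p≡ₘa (p ∸ a % p)) (sym (a%p≡ₘa a)) ⟩
    ((p ∸ a % p) + a % p) % p     ≡⟨ cong (_% p) (m∸n+n≡m (m%n≤n a p)) ⟩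
    p % p                         ≡⟨ trans (n%n≡0 p) (sym 0%p≡0) ⟩
    0 % p                         ∎)
    where open ≡-Reasoning

  open IntegralDomain ℤ/p using (NoZeroDivisors)

  module _ (prime : Prime p) where

    private
      p>1 : 1 < p
      p>1 = nonTrivial⇒n>1 p {{prime⇒nonTrivial prime}}

    1≢ₘ0 : ¬ 1 ≡ₘ 0
    1≢ₘ0 1≡ₘ0 with trans (sym (m<n⇒m%n≡m p>1)) (trans 1≡ₘ0 0%p≡0)
    ... | ()

    ℤ/p-noZeroDivisors : NoZeroDivisors
    ℤ/p-noZeroDivisors a b ab≡ₘ0 =
      ⊎-map (∣⇒≡ₘ0 a) (∣⇒≡ₘ0 b) (euclidsLemma a b prime (≡ₘ0⇒∣ (a * b) ab≡ₘ0))

    p∤m! : ∀ {m} → m < p → ¬ p ∣ m !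
    p∤m! {zero} _ p∣1 = <-irrefl (sym (∣1⇒≡1 p∣1)) p>1
    p∤m! {suc m} 1+m<p p∣[1+m]! =
      [ >⇒∤ 1+m<p , p∤m! (<-trans (n<1+n m) 1+m<p) ]′ (euclidsLemma (suc m) (m !) prime p∣[1+m]!)

    -- p divides p! = (p C k) k! (p - k)! but none of the factorials.
    p∣pCk : ∀ {k} → 0 < k → k < p → p ∣ p C k
    p∣pCk {k} 0<k k<p with euclidsLemma (p C k) (k ! * (p ∸ k) !) prime p∣pCk*k![p-k]!
      where
      p∣pCk*k![p-k]! : p ∣ (p C k) * (k ! * (p ∸ k) !)
      p∣pCk*k![p-k]! = subst (p ∣_) (sym pCk*k![p-k]!≡p!) (subst (λ n → n ∣ n !) (suc-pred p) (m∣m*n (pred p !)))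
        where
        pCk*k![p-k]!≡p! : (p C k) * (k ! * (p ∸ k) !) ≡ p !
        pCk*k![p-k]!≡p! = trans (cong (_* (k ! * (p ∸ k) !)) (nCk≡n!/k![n-k]! (<⇒≤ k<p)))
                    (m/n*n≡m {{k !* (p ∸ k) !≢0}} (k![n∸k]!∣n! (<⇒≤ k<p)))
    ... | inj₁ p∣pCk = p∣pCk
    ... | inj₂ p∣k![p-k]! = ⊥-elim $
      [ p∤m! k<p , p∤m! (∸-monoʳ-< 0<k (<⇒≤ k<p)) ]′ (euclidsLemma (k !) ((p ∸ k) !) prime p∣k![p-k]!)

    open BinomialWithVanishingMiddle (CommutativeRing.commutativeSemiring ℤ/p) using ([x+y]^n≈y^n+x^n)
    open import Algebra.Properties.Semiring.Mult (CommutativeRing.semiring ℤ/p) using (_×_)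
    open import Algebra.Properties.Semiring.Exp (CommutativeRing.semiring ℤ/p) using () renaming (_^_ to _^ᴿ_)
    open IntegralDomain ℤ/p using (*-cancelˡ-nonzero)

    n×x≡n*x : ∀ n x → n × x ≡ n * x
    n×x≡n*x zero x = refl
    n×x≡n*x (suc n) x = cong (x +_) (n×x≡n*x n x)

    x^ᴿn≡x^n : ∀ x n → x ^ᴿ n ≡ x ^ n
    x^ᴿn≡x^n x zero = refl
    x^ᴿn≡x^n x (suc n) = cong (x *_) (x^ᴿn≡x^n x n)

    [x+y]^p≡ₘy^p+x^p : ∀ x y → (x + y) ^ p ≡ₘ y ^ p + x ^ p
    [x+y]^p≡ₘy^p+x^p x y = subst (λ n → (x + y) ^ n ≡ₘ y ^ n + x ^ n) (suc-pred p) (begin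
      ((x + y) ^ q) % p              ≡⟨ ≡⇒≡ₘ (x^ᴿn≡x^n (x + y) q) ⟨
      ((x + y) ^ᴿ q) % p             ≡⟨ [x+y]^n≈y^n+x^n (pred p) middle≡ₘ0 x y ⟩
      (y ^ᴿ q + x ^ᴿ q) % p          ≡⟨ ≡⇒≡ₘ (cong₂ _+_ (x^ᴿn≡x^n y q) (x^ᴿn≡x^n x q)) ⟩
      (y ^ q + x ^ q) % p            ∎)
      where
      open ≡-Reasoning
      q : ℕ
      q = suc (pred p)
      q≡p : q ≡ p
      q≡p = suc-pred p
      middle≡ₘ0 : ∀ k z → 0 < k → k < q → (q C k) × z ≡ₘ 0
      middle≡ₘ0 k z 0<k k<q = subst (λ n → (n C k) × z ≡ₘ 0) (sym q≡p) (begin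
        ((p C k) × z) % p    ≡⟨ ≡⇒≡ₘ (n×x≡n*x (p C k) z) ⟩
        ((p C k) * z) % p    ≡⟨ *-congₘ (∣⇒≡ₘ0 (p C k) (p∣pCk 0<k (subst (k <_) q≡p k<q))) refl ⟩
        0 % p                ∎)

    fermat : ∀ x → x ^ p ≡ₘ x
    fermat zero = ≡⇒≡ₘ (subst (λ n → 0 ^ n ≡ 0) (suc-pred p) refl)
    fermat (suc x) = begin
      (1 + x) ^ p % p        ≡⟨ [x+y]^p≡ₘy^p+x^p 1 x ⟩
      (x ^ p + 1 ^ p) % p    ≡⟨ +-congₘ (fermat x) (≡⇒≡ₘ (^-zeroˡ p)) ⟩
      (x + 1) % p            ≡⟨ ≡⇒≡ₘ (+-comm x 1) ⟩
      suc x % p              ∎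
      where open ≡-Reasoning

    fermat-inverse : ∀ a → ¬ a ≡ₘ 0 → a * a ^ (p ∸ 2) ≡ₘ 1
    fermat-inverse a a≢ₘ0 = *-cancelˡ-nonzero ℤ/p-noZeroDivisors a (a * a ^ (p ∸ 2)) 1 a≢ₘ0 (begin
      a * (a * a ^ (p ∸ 2)) % p   ≡⟨ ≡⇒≡ₘ (cong (a ^_) (m+[n∸m]≡n p>1)) ⟩
      a ^ p % p                   ≡⟨ fermat a ⟩
      a % p                       ≡⟨ ≡⇒≡ₘ (*-identityʳ a) ⟨
      a * 1 % p                   ∎)
      where open ≡-Reasoning


module Polynomials (p : ℕ) .{{_ : NonZero p}} where

  open import Data.Nat
  open import Data.Nat.Properties
  open import Data.List using (List; []; _∷_; _++_; map; length)
  open import Data.List.Properties using (++-identityʳ)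
  open import Data.Fin using (zero; suc; toℕ)
  open import Data.Vec using ([]; _∷_)
  open import Data.Product using (Σ; _×_; _,_)
  open import Data.Sum using (_⊎_; inj₁; inj₂)
  open import Data.Empty using (⊥-elim)
  open import Function using (_∘_)
  open import Relation.Binary.PropositionalEquality
  open import Relation.Nullary using (¬_; Dec; yes; no)
  open import Data.Nat.Solver using (module +-*-Solver)
  open +-*-Solver
  open Fp p
  open Residues p
  open CommutativeRingFromLaws
  module ℤp = CommutativeRing ℤ/p

  coeff : List ℕ → ℕ → ℕ
  coeff [] n = 0
  coeff (a ∷ f) zero = a
  coeff (a ∷ f) (suc n) = coeff f n

  scale : ℕ → List ℕ → List ℕ
  scale c f = map (c *_) f

  infix 4 _≐_ _≈ₚ_
  _≐_ : List ℕ → List ℕ → Set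
  f ≐ g = ∀ n → coeff f n ≡ coeff g n

  record _≈ₚ_ (f g : List ℕ) : Set where
    constructor by-coeff
    field coeff-≡ₘ : ∀ n → coeff f n ≡ₘ coeff g n
  open _≈ₚ_ public

  ≐⇒≈ₚ : ∀ {f g} → f ≐ g → f ≈ₚ g
  ≐⇒≈ₚ f≐g = by-coeff λ n → ≡⇒≡ₘ (f≐g n)

  coeff-addP : ∀ f g n → coeff (addP f g) n ≡ coeff f n + coeff g n
  coeff-addP [] g n = refl
  coeff-addP (a ∷ f) [] n = sym (+-identityʳ _)
  coeff-addP (a ∷ f) (b ∷ g) zero = refl
  coeff-addP (a ∷ f) (b ∷ g) (suc n) = coeff-addP f g n

  coeff-scale : ∀ c f n → coeff (scale c f) n ≡ c * coeff f n
  coeff-scale c [] n = sym (*-zeroʳ c)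
  coeff-scale c (a ∷ f) zero = refl
  coeff-scale c (a ∷ f) (suc n) = coeff-scale c f n

  coeff-mulP-∷ˡ : ∀ a f g n → coeff (mulP (a ∷ f) g) n ≡ a * coeff g n + coeff (0 ∷ mulP f g) n
  coeff-mulP-∷ˡ a f g n =
    trans (coeff-addP (scale a g) (0 ∷ mulP f g) n) (cong (_+ coeff (0 ∷ mulP f g) n) (coeff-scale a g n))

  coeff-mulP-∷ʳ : ∀ f b g n → coeff (mulP f (b ∷ g)) n ≡ coeff f n * b + coeff (0 ∷ mulP f g) n
  coeff-mulP-∷ʳ [] b g zero = refl
  coeff-mulP-∷ʳ [] b g (suc n) = refl
  coeff-mulP-∷ʳ (a ∷ f) b g zero = coeff-mulP-∷ˡ a f (b ∷ g) zero
  coeff-mulP-∷ʳ (a ∷ f) b g (suc n) = begin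
    coeff (mulP (a ∷ f) (b ∷ g)) (suc n)                      ≡⟨ coeff-mulP-∷ˡ a f (b ∷ g) (suc n) ⟩
    a * coeff g n + coeff (mulP f (b ∷ g)) n                  ≡⟨ cong (a * coeff g n +_) (coeff-mulP-∷ʳ f b g n) ⟩
    a * coeff g n + (coeff f n * b + coeff (0 ∷ mulP f g) n)  ≡⟨ solve 3 (λ x y z → x :+ (y :+ z) := y :+ (x :+ z))
                                                                      refl (a * coeff g n) (coeff f n * b) _ ⟩
    coeff f n * b + (a * coeff g n + coeff (0 ∷ mulP f g) n)  ≡⟨ cong (coeff f n * b +_) (coeff-mulP-∷ˡ a f g n) ⟨
    coeff f n * b + coeff (mulP (a ∷ f) g) n                  ∎
    where open ≡-Reasoning

  ∷-cong≐ : ∀ {f g} → f ≐ g → (0 ∷ f) ≐ (0 ∷ g)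
  ∷-cong≐ f≐g zero = refl
  ∷-cong≐ f≐g (suc n) = f≐g n

  addP-cong≐ : ∀ f f' g g' → f ≐ f' → g ≐ g' → addP f g ≐ addP f' g'
  addP-cong≐ f f' g g' f≐ g≐ n =
    trans (coeff-addP f g n) (trans (cong₂ _+_ (f≐ n) (g≐ n)) (sym (coeff-addP f' g' n)))

  mulP-zeroʳ : ∀ f → mulP f [] ≐ []
  mulP-zeroʳ [] n = refl
  mulP-zeroʳ (a ∷ f) zero = trans (coeff-mulP-∷ˡ a f [] zero) (trans (+-identityʳ (a * 0)) (*-zeroʳ a))
  mulP-zeroʳ (a ∷ f) (suc n) =
    trans (coeff-mulP-∷ˡ a f [] (suc n)) (trans (cong (_+ coeff (mulP f []) n) (*-zeroʳ a)) (mulP-zeroʳ f n))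

  coeff-0∷[] : ∀ n → coeff (0 ∷ []) n ≡ 0
  coeff-0∷[] zero = refl
  coeff-0∷[] (suc n) = refl

  scale≐constant* : ∀ c f → scale c f ≐ mulP (c ∷ []) f
  scale≐constant* c f n = trans (coeff-scale c f n)
    (sym (trans (coeff-mulP-∷ˡ c [] f n) (trans (cong (c * coeff f n +_) (coeff-0∷[] n)) (+-identityʳ _))))

  mulP-identityˡ : ∀ f → mulP (1 ∷ []) f ≐ f
  mulP-identityˡ f n = trans (sym (scale≐constant* 1 f n)) (trans (coeff-scale 1 f n) (*-identityˡ _))

  mulP-comm : ∀ f g → mulP f g ≐ mulP g f
  mulP-comm [] g n = sym (mulP-zeroʳ g n)
  mulP-comm (a ∷ f) g n = begin
    coeff (mulP (a ∷ f) g) n                ≡⟨ coeff-mulP-∷ˡ a f g n ⟩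
    a * coeff g n + coeff (0 ∷ mulP f g) n  ≡⟨ cong₂ _+_ (*-comm a (coeff g n)) (∷-cong≐ (mulP-comm f g) n) ⟩
    coeff g n * a + coeff (0 ∷ mulP g f) n  ≡⟨ coeff-mulP-∷ʳ g a f n ⟨
    coeff (mulP g (a ∷ f)) n                ∎
    where open ≡-Reasoning

  mulP-distribˡ : ∀ f g h → mulP f (addP g h) ≐ addP (mulP f g) (mulP f h)
  mulP-distribˡ [] g h n = refl
  mulP-distribˡ (a ∷ f) g h n = begin
    coeff (mulP (a ∷ f) (addP g h)) n                      ≡⟨ coeff-mulP-∷ˡ a f (addP g h) n ⟩
    a * coeff (addP g h) n + coeff (0 ∷ mulP f (addP g h)) n
                                                           ≡⟨ cong₂ (λ x y → a * x + y) (coeff-addP g h n)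
                                                                (trans (∷-cong≐ (mulP-distribˡ f g h) n)
                                                                       (coeff-addP (0 ∷ mulP f g) (0 ∷ mulP f h) n)) ⟩
    a * (G + H) + (FG + FH)                                ≡⟨ solve 5 (λ a x y u v → a :* (x :+ y) :+ (u :+ v)
                                                                          := (a :* x :+ u) :+ (a :* y :+ v))
                                                                refl a G H FG FH ⟩
    (a * G + FG) + (a * H + FH)                            ≡⟨ cong₂ _+_ (coeff-mulP-∷ˡ a f g n) (coeff-mulP-∷ˡ a f h n) ⟨
    coeff (mulP (a ∷ f) g) n + coeff (mulP (a ∷ f) h) n    ≡⟨ coeff-addP (mulP (a ∷ f) g) (mulP (a ∷ f) h) n ⟨
    coeff (addP (mulP (a ∷ f) g) (mulP (a ∷ f) h)) n       ∎
    where
    open ≡-Reasoning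
    G H FG FH : ℕ
    G = coeff g n
    H = coeff h n
    FG = coeff (0 ∷ mulP f g) n
    FH = coeff (0 ∷ mulP f h) n

  mulP-scaleʳ : ∀ f c g → mulP f (scale c g) ≐ scale c (mulP f g)
  mulP-scaleʳ [] c g n = refl
  mulP-scaleʳ (a ∷ f) c g n = begin
    coeff (mulP (a ∷ f) (scale c g)) n                         ≡⟨ coeff-mulP-∷ˡ a f (scale c g) n ⟩
    a * coeff (scale c g) n + coeff (0 ∷ mulP f (scale c g)) n ≡⟨ cong₂ (λ x y → a * x + y) (coeff-scale c g n)
                                                                    (trans (∷-cong≐ (mulP-scaleʳ f c g) n) (coeff-0∷-scale (mulP f g) n)) ⟩
    a * (c * coeff g n) + c * FG                               ≡⟨ solve 4 (λ a c x y → a :* (c :* x) :+ c :* y := c :* (a :* x :+ y))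
                                                                    refl a c (coeff g n) FG ⟩
    c * (a * coeff g n + FG)                                   ≡⟨ cong (c *_) (coeff-mulP-∷ˡ a f g n) ⟨
    c * coeff (mulP (a ∷ f) g) n                               ≡⟨ coeff-scale c (mulP (a ∷ f) g) n ⟨
    coeff (scale c (mulP (a ∷ f) g)) n                         ∎
    where
    open ≡-Reasoning
    FG : ℕ
    FG = coeff (0 ∷ mulP f g) n
    coeff-0∷-scale : ∀ h m → coeff (0 ∷ scale c h) m ≡ c * coeff (0 ∷ h) m
    coeff-0∷-scale h zero = sym (*-zeroʳ c)
    coeff-0∷-scale h (suc m) = coeff-scale c h m

  mulP-assoc : ∀ f g h → mulP (mulP f g) h ≐ mulP f (mulP g h)
  mulP-assoc [] g h n = refl
  mulP-assoc (a ∷ f) g h n = begin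
    coeff (mulP (mulP (a ∷ f) g) h) n                            ≡⟨ mulP-comm (mulP (a ∷ f) g) h n ⟩
    coeff (mulP h (addP (scale a g) (0 ∷ mulP f g))) n           ≡⟨ mulP-distribˡ h (scale a g) (0 ∷ mulP f g) n ⟩
    coeff (addP (mulP h (scale a g)) (mulP h (0 ∷ mulP f g))) n  ≡⟨ addP-cong≐ (mulP h (scale a g)) (scale a (mulP g h)) (mulP h (0 ∷ mulP f g)) (0 ∷ mulP f (mulP g h)) hag≐ hfg≐ n ⟩
    coeff (addP (scale a (mulP g h)) (0 ∷ mulP f (mulP g h))) n  ∎
    where
    open ≡-Reasoning
    hag≐ : mulP h (scale a g) ≐ scale a (mulP g h)
    hag≐ m = trans (mulP-scaleʳ h a g m)
               (trans (coeff-scale a (mulP h g) m) (trans (cong (a *_) (mulP-comm h g m)) (sym (coeff-scale a (mulP g h) m))))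
    hfg≐ : mulP h (0 ∷ mulP f g) ≐ (0 ∷ mulP f (mulP g h))
    hfg≐ m = trans (coeff-mulP-∷ʳ h 0 (mulP f g) m)
               (trans (cong (_+ coeff (0 ∷ mulP h (mulP f g)) m) (*-zeroʳ (coeff h m)))
                      (∷-cong≐ (λ i → trans (mulP-comm h (mulP f g) i) (mulP-assoc f g h i)) m))

  addP-congₘ : ∀ {f f' g g'} → f ≈ₚ f' → g ≈ₚ g' → addP f g ≈ₚ addP f' g'
  addP-congₘ {f} {f'} {g} {g'} f≈ g≈ = by-coeff λ n →
    trans (≡⇒≡ₘ (coeff-addP f g n)) (trans (+-congₘ (coeff-≡ₘ f≈ n) (coeff-≡ₘ g≈ n)) (≡⇒≡ₘ (sym (coeff-addP f' g' n))))

  scale-congₘ : ∀ {c c' f f'} → c ≡ₘ c' → f ≈ₚ f' → scale c f ≈ₚ scale c' f'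
  scale-congₘ {c} {c'} {f} {f'} c≡ f≈ = by-coeff λ n →
    trans (≡⇒≡ₘ (coeff-scale c f n)) (trans (*-congₘ c≡ (coeff-≡ₘ f≈ n)) (≡⇒≡ₘ (sym (coeff-scale c' f' n))))

  ∷-congₘ : ∀ {a a' f f'} → a ≡ₘ a' → f ≈ₚ f' → (a ∷ f) ≈ₚ (a' ∷ f')
  ∷-congₘ a≡ f≈ = by-coeff λ { zero → a≡ ; (suc n) → coeff-≡ₘ f≈ n }

  mulP-congʳₘ : ∀ f {g g'} → g ≈ₚ g' → mulP f g ≈ₚ mulP f g'
  mulP-congʳₘ [] g≈ = by-coeff λ n → refl
  mulP-congʳₘ (a ∷ f) {g} {g'} g≈ = by-coeff λ n →
    trans (≡⇒≡ₘ (coeff-mulP-∷ˡ a f g n))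
      (trans (+-congₘ (*-congₘ {a} refl (coeff-≡ₘ g≈ n)) (coeff-≡ₘ (∷-congₘ refl (mulP-congʳₘ f g≈)) n))
             (≡⇒≡ₘ (sym (coeff-mulP-∷ˡ a f g' n))))

  mulP-congₘ : ∀ {f f' g g'} → f ≈ₚ f' → g ≈ₚ g' → mulP f g ≈ₚ mulP f' g'
  mulP-congₘ {f} {f'} {g} {g'} f≈ g≈ = by-coeff λ n →
    trans (coeff-≡ₘ (mulP-congʳₘ f g≈) n)
      (trans (≡⇒≡ₘ (mulP-comm f g' n)) (trans (coeff-≡ₘ (mulP-congʳₘ g' f≈) n) (≡⇒≡ₘ (mulP-comm g' f' n))))

  ℤ/p[x] : CommutativeRing 0ℓ 0ℓ
  ℤ/p[x] = commutativeRing record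
    { _≈_ = _≈ₚ_ ; _+_ = addP ; _*_ = mulP ; -_ = scale (p ∸ 1) ; 0# = [] ; 1# = 1 ∷ []
    ; isEquivalence = record { refl = by-coeff λ n → refl
                             ; sym = λ f≈g → by-coeff λ n → sym (coeff-≡ₘ f≈g n)
                             ; trans = λ f≈g g≈h → by-coeff λ n → trans (coeff-≡ₘ f≈g n) (coeff-≡ₘ g≈h n) }
    ; +-cong = addP-congₘ ; *-cong = mulP-congₘ ; -‿cong = scale-congₘ {p ∸ 1} refl
    ; +-assoc = λ f g h → ≐⇒≈ₚ λ n → begin
        coeff (addP (addP f g) h) n             ≡⟨ trans (coeff-addP (addP f g) h n) (cong (_+ coeff h n) (coeff-addP f g n)) ⟩
        (coeff f n + coeff g n) + coeff h n     ≡⟨ +-assoc (coeff f n) (coeff g n) (coeff h n) ⟩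
        coeff f n + (coeff g n + coeff h n)     ≡⟨ trans (coeff-addP f (addP g h) n) (cong (coeff f n +_) (coeff-addP g h n)) ⟨
        coeff (addP f (addP g h)) n             ∎
    ; +-comm = λ f g → ≐⇒≈ₚ λ n →
        trans (coeff-addP f g n) (trans (+-comm (coeff f n) (coeff g n)) (sym (coeff-addP g f n)))
    ; +-identityˡ = λ f → by-coeff λ n → refl
    ; -‿inverseˡ = λ f → by-coeff λ n →
        trans (≡⇒≡ₘ (trans (coeff-addP (scale (p ∸ 1) f) f n) (cong (_+ coeff f n) (coeff-scale (p ∸ 1) f n))))
              (-ₘx+x≡ₘ0 (coeff f n))
    ; *-assoc = λ f g h → ≐⇒≈ₚ (mulP-assoc f g h)
    ; *-comm = λ f g → ≐⇒≈ₚ (mulP-comm f g)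
    ; *-identityˡ = λ f → ≐⇒≈ₚ (mulP-identityˡ f)
    ; distribʳ = λ f g h → ≐⇒≈ₚ λ n →
        trans (mulP-comm (addP g h) f n)
          (trans (mulP-distribˡ f g h n) (addP-cong≐ (mulP f g) (mulP g f) (mulP f h) (mulP h f) (mulP-comm f g) (mulP-comm f h) n)) }
    where open ≡-Reasoning

  module Pol = CommutativeRing ℤ/p[x]

  private
    singleton : ℕ → List ℕ
    singleton zero = []
    singleton (suc b) = suc b ∷ []

    consStripped : ℕ → List ℕ → List ℕ
    consStripped a [] = singleton a
    consStripped a (r ∷ rs) = a ∷ r ∷ rs

  stripZeros-∷ : ∀ a as → stripZeros (a ∷ as) ≡ consStripped a (stripZeros as)
  stripZeros-∷ a as with stripZeros as
  ... | [] with a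
  ...   | zero = refl
  ...   | suc b = refl
  stripZeros-∷ a as | r ∷ rs = refl

  stripZeros-cong : ∀ xs ys → xs ≐ ys → stripZeros xs ≡ stripZeros ys
  stripZeros-cong [] [] xs≐ys = refl
  stripZeros-cong [] (y ∷ ys) xs≐ys =
    sym (trans (stripZeros-∷ y ys) (cong₂ consStripped (sym (xs≐ys 0)) (sym (stripZeros-cong [] ys (xs≐ys ∘ suc)))))
  stripZeros-cong (x ∷ xs) [] xs≐ys =
    trans (stripZeros-∷ x xs) (cong₂ consStripped (xs≐ys 0) (stripZeros-cong xs [] (xs≐ys ∘ suc)))
  stripZeros-cong (x ∷ xs) (y ∷ ys) xs≐ys =
    trans (stripZeros-∷ x xs) (trans (cong₂ consStripped (xs≐ys 0) (stripZeros-cong xs ys (xs≐ys ∘ suc))) (sym (stripZeros-∷ y ys)))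

  coeff-map-% : ∀ f m → coeff (map (_% p) f) m ≡ coeff f m % p
  coeff-map-% [] m = sym 0%p≡0
  coeff-map-% (a ∷ f) zero = refl
  coeff-map-% (a ∷ f) (suc m) = coeff-map-% f m

  normP-cong : ∀ {f f'} → f ≈ₚ f' → normP f ≡ normP f'
  normP-cong {f} {f'} f≈f' = stripZeros-cong (map (_% p) f) (map (_% p) f')
    (λ m → trans (coeff-map-% f m) (trans (coeff-≡ₘ f≈f' m) (sym (coeff-map-% f' m))))

  stripZeros≡[]⇒coeff≡0 : ∀ xs → stripZeros xs ≡ [] → ∀ m → coeff xs m ≡ 0
  stripZeros≡[]⇒coeff≡0 [] _ m = refl
  stripZeros≡[]⇒coeff≡0 (a ∷ as) eq m with stripZeros as in eq' | stripZeros-∷ a as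
  stripZeros≡[]⇒coeff≡0 (zero ∷ as) eq zero | [] | _ = refl
  stripZeros≡[]⇒coeff≡0 (zero ∷ as) eq (suc m) | [] | _ = stripZeros≡[]⇒coeff≡0 as eq' m
  stripZeros≡[]⇒coeff≡0 (suc a ∷ as) eq m | [] | s∷≡ with trans (sym s∷≡) eq
  ... | ()
  stripZeros≡[]⇒coeff≡0 (a ∷ as) eq m | r ∷ rs | s∷≡ with trans (sym s∷≡) eq
  ... | ()

  length-stripZeros≤1⇒coeff≡0 : ∀ xs → length (stripZeros xs) ≤ 1 → ∀ m → 1 ≤ m → coeff xs m ≡ 0
  length-stripZeros≤1⇒coeff≡0 (a ∷ as) len≤1 (suc m) _ with stripZeros as in eq | stripZeros-∷ a as
  ... | [] | _ = stripZeros≡[]⇒coeff≡0 as eq m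
  ... | r ∷ rs | s∷≡ with subst (λ z → length z ≤ 1) s∷≡ len≤1
  ... | s≤s ()
  length-stripZeros≤1⇒coeff≡0 [] _ m _ = refl

  2≤length-normP : ∀ f → ¬ (∀ m → 1 ≤ m → coeff f m ≡ₘ 0) → 2 ≤ length (normP f)
  2≤length-normP f nonconstant with 2 ≤? length (normP f)
  ... | yes 2≤len = 2≤len
  ... | no 2≰len = ⊥-elim (nonconstant λ m 1≤m →
    trans (sym (coeff-map-% f m))
      (trans (length-stripZeros≤1⇒coeff≡0 (map (_% p) f) (≤-pred (≰⇒> 2≰len)) m 1≤m) (sym 0%p≡0)))

  data IndexView (n : ℕ) : ℕ → Set where
    inside : (i : Fin n) → IndexView n (toℕ i)
    beyond : (k : ℕ) → IndexView n (n + k)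

  indexView : ∀ n m → IndexView n m
  indexView zero m = beyond m
  indexView (suc n) zero = inside zero
  indexView (suc n) (suc m) with indexView n m
  ... | inside i = inside (suc i)
  ... | beyond k = beyond k

  coeff-++-inside : ∀ {n} (v : Vec ℕ n) L i → coeff (toList v ++ L) (toℕ i) ≡ lookup v i
  coeff-++-inside (a ∷ v) L zero = refl
  coeff-++-inside (a ∷ v) L (suc i) = coeff-++-inside v L i

  coeff-++-beyond : ∀ {n} (v : Vec ℕ n) L k → coeff (toList v ++ L) (n + k) ≡ coeff L k
  coeff-++-beyond [] L k = refl
  coeff-++-beyond (a ∷ v) L k = coeff-++-beyond v L k

  coeff-toList-inside : ∀ {n} (v : Vec ℕ n) i → coeff (toList v) (toℕ i) ≡ lookup v i
  coeff-toList-inside v i = trans (cong (λ l → coeff l _) (sym (++-identityʳ (toList v)))) (coeff-++-inside v [] i)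

  coeff-toList-beyond : ∀ {n} (v : Vec ℕ n) k → coeff (toList v) (n + k) ≡ 0
  coeff-toList-beyond v k = trans (cong (λ l → coeff l _) (sym (++-identityʳ (toList v)))) (coeff-++-beyond v [] k)

  DegreeBelow : ℕ → List ℕ → Set
  DegreeBelow n f = ∀ m → n ≤ m → coeff f m ≡ₘ 0

  toList-degreeBelow : ∀ {n} (v : Vec ℕ n) → DegreeBelow n (toList v)
  toList-degreeBelow {n} v m n≤m =
    ≡⇒≡ₘ (subst (λ i → coeff (toList v) i ≡ 0) (m+[n∸m]≡n n≤m) (coeff-toList-beyond v (m ∸ n)))

  Degree : ℕ → List ℕ → Set
  Degree d f = DegreeBelow (suc d) f × ¬ coeff f d ≡ₘ 0

  zero-or-degree : ∀ n f → DegreeBelow n f → f ≈ₚ [] ⊎ Σ ℕ λ d → d < n × Degree d f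
  zero-or-degree zero f f<0 = inj₁ (by-coeff λ m → f<0 m z≤n)
  zero-or-degree (suc n) f f<1+n with coeff f n ≡ₘ? 0
  ... | no fₙ≢0 = inj₂ (n , ≤-refl , f<1+n , fₙ≢0)
  ... | yes fₙ≡0 with zero-or-degree n f f<n
    where
    f<n : DegreeBelow n f
    f<n m n≤m with m ≟ n
    ... | yes refl = fₙ≡0
    ... | no m≢n = f<1+n m (≤∧≢⇒< n≤m (m≢n ∘ sym))
  ... | inj₁ f≈0 = inj₁ f≈0
  ... | inj₂ (d , d<n , deg) = inj₂ (d , m<n⇒m<1+n d<n , deg)

  toList≈[]? : ∀ {n} (v : Vec ℕ n) → Dec (toList v ≈ₚ [])
  toList≈[]? [] = yes (by-coeff λ m → refl)
  toList≈[]? (a ∷ v) with a ≡ₘ? 0 | toList≈[]? v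
  ... | yes a≡0 | yes v≈0 = yes (by-coeff λ { zero → a≡0 ; (suc m) → coeff-≡ₘ v≈0 m })
  ... | no a≢0 | _ = no λ a∷v≈0 → a≢0 (coeff-≡ₘ a∷v≈0 0)
  ... | yes _ | no v≉0 = no λ a∷v≈0 → v≉0 (by-coeff λ m → coeff-≡ₘ a∷v≈0 (suc m))

  monomial : ℕ → ℕ → List ℕ
  monomial zero u = u ∷ []
  monomial (suc k) u = 0 ∷ monomial k u

  coeff-monomial* : ∀ k u A j → coeff (mulP (monomial k u) A) (k + j) ≡ u * coeff A j
  coeff-monomial* zero u A j = trans (sym (scale≐constant* u A j)) (coeff-scale u A j)
  coeff-monomial* (suc k) u A j = trans (coeff-mulP-∷ˡ 0 (monomial k u) A (suc (k + j))) (coeff-monomial* k u A j)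

  coeff-sub : ∀ F G m → coeff (F Pol.- G) m ≡ coeff F m + -ₘ coeff G m
  coeff-sub F G m = trans (coeff-addP F (scale (p ∸ 1) G) m) (cong (coeff F m +_) (coeff-scale (p ∸ 1) G m))

  record Division (F A : List ℕ) (d : ℕ) : Set where
    constructor division
    field
      quotient remainder : List ℕ
      decomposition : F ≈ₚ addP (mulP quotient A) remainder
      remainder-degree : DegreeBelow d remainder

  module _ (prime : Prime p) where

    -- With u = F_N / A_d and k = N - d, subtracting u xᵏ A kills the coefficient of degree N.
    cancel-leading : ∀ {A d} → Degree d A → ∀ {N} F → d ≤ N → DegreeBelow (suc N) F →
                     Σ (List ℕ) λ T → DegreeBelow N (F Pol.- mulP T A)
    cancel-leading {A} {d} (A<1+d , A_d≢0) {N} F d≤N F<1+N = monomial k u , F-TA<N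
      where
      k u : ℕ
      k = N ∸ d
      u = coeff F N * coeff A d ^ (p ∸ 2)
      TA : List ℕ
      TA = mulP (monomial k u) A
      uA_d≡ₘF_N : u * coeff A d ≡ₘ coeff F N
      uA_d≡ₘF_N = begin
        u * coeff A d                                        ≡⟨ *-assoc (coeff F N) _ (coeff A d) ⟩
        coeff F N * (coeff A d ^ (p ∸ 2) * coeff A d)        ≡⟨ cong (coeff F N *_) (*-comm _ (coeff A d)) ⟩
        coeff F N * (coeff A d * coeff A d ^ (p ∸ 2))        ≈⟨ *-congₘ {coeff F N} refl (fermat-inverse prime (coeff A d) A_d≢0) ⟩
        coeff F N * 1                                        ≡⟨ *-identityʳ _ ⟩
        coeff F N                                            ∎
        where open import Relation.Binary.Reasoning.Setoid ℤp.setoid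
      F-TA<N : DegreeBelow N (F Pol.- TA)
      F-TA<N m N≤m rewrite coeff-sub F TA m with m ≟ N
      ... | yes refl = ℤp.trans (ℤp.+-congˡ (ℤp.-‿cong TA_N≡ₘF_N)) (ℤp.-‿inverseʳ (coeff F N))
        where
        TA_N≡ₘF_N : coeff TA N ≡ₘ coeff F N
        TA_N≡ₘF_N = ℤp.trans (≡⇒≡ₘ (subst (λ i → coeff TA i ≡ u * coeff A d) (m∸n+n≡m d≤N)
                                           (coeff-monomial* k u A d))) uA_d≡ₘF_N
      ... | no m≢N = ℤp.trans (ℤp.+-cong (F<1+N m N<m) (ℤp.-‿cong TA_m≡ₘ0)) (≡⇒≡ₘ (*-zeroʳ (p ∸ 1)))
        where
        N<m : N < m
        N<m = ≤∧≢⇒< N≤m (m≢N ∘ sym)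
        k+[m∸k]≡m : k + (m ∸ k) ≡ m
        k+[m∸k]≡m = m+[n∸m]≡n (≤-trans (m∸n≤m N d) N≤m)
        d<m∸k : d < m ∸ k
        d<m∸k = +-cancelˡ-< k d (m ∸ k) (subst₂ _<_ (sym (m∸n+n≡m d≤N)) (sym k+[m∸k]≡m) N<m)
        TA_m≡ₘ0 : coeff TA m ≡ₘ 0
        TA_m≡ₘ0 = ℤp.trans (≡⇒≡ₘ (trans (cong (coeff TA) (sym k+[m∸k]≡m)) (coeff-monomial* k u A (m ∸ k))))
                           (ℤp.trans (*-congₘ {u} refl (A<1+d (m ∸ k) d<m∸k)) (≡⇒≡ₘ (*-zeroʳ u)))

    divide : ∀ {A d} → Degree d A → ∀ N F → DegreeBelow N F → Division F A d
    divide degA zero F F<0 = division [] F Pol.refl (λ m _ → F<0 m z≤n)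
    divide {A} {d} degA (suc N) F F<1+N with N <? d
    ... | yes N<d = division [] F Pol.refl (λ m d≤m → F<1+N m (≤-trans N<d d≤m))
    ... | no N≮d with cancel-leading degA F (≮⇒≥ N≮d) F<1+N
    ...   | T , F-TA<N with divide degA N (F Pol.- mulP T A) F-TA<N
    ...     | division S R F-TA≈SA+R R<d = division (addP S T) R F≈[S+T]A+R R<d
      where
      open import Relation.Binary.Reasoning.Setoid Pol.setoid
      open import Algebra.Properties.Group Pol.+-group using (//-rightDividesˡ)
      open import Algebra.Properties.CommutativeSemigroup Pol.+-commutativeSemigroup using (xy∙z≈xz∙y)
      F≈[S+T]A+R : F ≈ₚ addP (mulP (addP S T) A) R
      F≈[S+T]A+R = begin
        F                                                 ≈⟨ //-rightDividesˡ (mulP T A) F ⟨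
        addP (F Pol.- mulP T A) (mulP T A)                ≈⟨ Pol.+-congʳ F-TA≈SA+R ⟩
        addP (addP (mulP S A) R) (mulP T A)               ≈⟨ xy∙z≈xz∙y (mulP S A) R (mulP T A) ⟩
        addP (addP (mulP S A) (mulP T A)) R               ≈⟨ Pol.+-congʳ (Pol.distribʳ A S T) ⟨
        addP (mulP (addP S T) A) R                        ∎


module Representation (p : ℕ) .{{_ : NonZero p}} (h' : ℕ) (g : Vec ℕ (suc (suc h'))) where

  open import Data.Nat
  open import Data.Nat.Properties
  open import Data.Fin using (Fin; zero; suc; toℕ; inject₁)
  open import Data.List using (List; []; _∷_; _++_)
  open import Data.Vec as V using (Vec; []; _∷_; lookup; toList; tabulate)
  open import Data.Vec.Properties using (lookup∘tabulate)
  open import Data.Product using (Σ; _,_; proj₁; proj₂)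
  open import Relation.Binary.PropositionalEquality
  open Fp p
  open GF p g
  open Residues p
  open Polynomials p

  h : ℕ
  h = suc h'

  ⟦_⟧ : ∀ {n} → Vec ℕ n → List ℕ
  ⟦ v ⟧ = toList v

  -- ĝ = λ (g₀ + g₁ x + … + g_{h-1} x^{h-1}) + x^h, monic by construction, where λ = lcInv is meant to
  -- invert g_h; mulX reduces modulo ĝ.
  ĝ-coeff : Fin h → ℕ
  ĝ-coeff i = lcInv * lookup g (inject₁ i)

  ĝ-low : Vec ℕ h
  ĝ-low = tabulate ĝ-coeff

  ĝ : List ℕ
  ĝ = ⟦ ĝ-low ⟧ ++ (1 ∷ [])

  coeff-ĝ-inside : ∀ i → coeff ĝ (toℕ i) ≡ lcInv * lookup g (inject₁ i)
  coeff-ĝ-inside i = trans (coeff-++-inside ĝ-low (1 ∷ []) i) (lookup∘tabulate ĝ-coeff i)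

  coeff-ĝ-h : coeff ĝ h ≡ 1
  coeff-ĝ-h = trans (cong (coeff ĝ) (sym (+-identityʳ h))) (coeff-++-beyond ĝ-low (1 ∷ []) 0)

  coeff-ĝ-beyond : ∀ k → coeff ĝ (h + suc k) ≡ 0
  coeff-ĝ-beyond k = coeff-++-beyond ĝ-low (1 ∷ []) (suc k)

  ⟦zeroQ⟧ : ⟦ zeroQ ⟧ ≈ₚ []
  ⟦zeroQ⟧ = ≐⇒≈ₚ (replicate0 h)
    where
    replicate0 : ∀ k → ⟦ V.replicate k 0 ⟧ ≐ []
    replicate0 zero n = refl
    replicate0 (suc k) zero = refl
    replicate0 (suc k) (suc n) = replicate0 k n

  ⟦oneQ⟧ : ⟦ oneQ ⟧ ≈ₚ (1 ∷ [])
  ⟦oneQ⟧ = ∷-congₘ (a%p≡ₘa 1) (zeros h')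
    where
    zeros : ∀ k → ⟦ V.map (_% p) (tabulate {n = k} (λ _ → 0)) ⟧ ≈ₚ []
    zeros zero = by-coeff λ n → refl
    zeros (suc k) = by-coeff λ { zero → a%p≡ₘa 0 ; (suc n) → coeff-≡ₘ (zeros k) n }

  ⟦+q⟧ : ∀ {n} (a b : Vec ℕ n) → ⟦ V.zipWith _+p_ a b ⟧ ≈ₚ addP ⟦ a ⟧ ⟦ b ⟧
  ⟦+q⟧ [] [] = by-coeff λ n → refl
  ⟦+q⟧ (x ∷ a) (y ∷ b) = ∷-congₘ (+p≡ₘ+ x y) (⟦+q⟧ a b)

  ⟦-q⟧ : ∀ {n} (a : Vec ℕ n) → ⟦ V.map -p_ a ⟧ ≈ₚ scale (p ∸ 1) ⟦ a ⟧
  ⟦-q⟧ [] = by-coeff λ n → refl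
  ⟦-q⟧ (x ∷ a) = ∷-congₘ (-p≡ₘ-ₘ x) (⟦-q⟧ a)

  push-toList : ∀ {n} x (r : Vec ℕ n) → ⟦ proj₁ (push x r) ⟧ ++ (proj₂ (push x r) ∷ []) ≡ x ∷ ⟦ r ⟧
  push-toList x [] = refl
  push-toList x (a ∷ as) with push a as | push-toList a as
  ... | s , t | s++t≡a∷as = cong (x ∷_) s++t≡a∷as

  mulX-correct : ∀ r → Σ ℕ λ t → (0 ∷ ⟦ r ⟧) ≈ₚ addP ⟦ mulX r ⟧ (scale t ĝ)
  mulX-correct r with push 0 r | push-toList 0 r
  ... | s , t | s++t≡0∷r = t , by-coeff coeff≡ₘ
    where
    F : Fin h → ℕ
    F i = lookup s i +p (-p ((t *p lcInv) *p lookup g (inject₁ i)))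
    F+tĝ≡ₘs : ∀ i → F i + t * ĝ-coeff i ≡ₘ lookup s i
    F+tĝ≡ₘs i = begin
      F i + tĝᵢ                    ≈⟨ ℤp.+-congʳ (trans (+p≡ₘ+ (lookup s i) (-p tλg))
                                                   (ℤp.+-congˡ (trans (-p≡ₘ-ₘ tλg) (ℤp.-‿cong tλg≡ₘtĝᵢ)))) ⟩
      (lookup s i + -ₘ tĝᵢ) + tĝᵢ    ≈⟨ //-rightDividesˡ tĝᵢ (lookup s i) ⟩
      lookup s i                   ∎
      where
      open import Relation.Binary.Reasoning.Setoid ℤp.setoid
      open import Algebra.Properties.Group ℤp.+-group using (//-rightDividesˡ)
      gᵢ tĝᵢ tλg : ℕ
      gᵢ = lookup g (inject₁ i)
      tĝᵢ = t * ĝ-coeff i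
      tλg = (t *p lcInv) *p gᵢ
      tλg≡ₘtĝᵢ : tλg ≡ₘ tĝᵢ
      tλg≡ₘtĝᵢ = trans (*p≡ₘ* (t *p lcInv) gᵢ) (trans (*-congₘ {b = gᵢ} (*p≡ₘ* t lcInv) refl) (≡⇒≡ₘ (*-assoc t lcInv gᵢ)))
    coeff≡ₘ : ∀ m → coeff (0 ∷ ⟦ r ⟧) m ≡ₘ coeff (addP ⟦ tabulate F ⟧ (scale t ĝ)) m
    coeff≡ₘ m rewrite sym s++t≡0∷r | coeff-addP ⟦ tabulate F ⟧ (scale t ĝ) m | coeff-scale t ĝ m
      with indexView h m
    ... | inside i rewrite coeff-++-inside s (t ∷ []) i | coeff-toList-inside (tabulate F) i
                         | lookup∘tabulate F i | coeff-ĝ-inside i = sym (F+tĝ≡ₘs i)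
    ... | beyond zero rewrite coeff-++-beyond s (t ∷ []) 0 | coeff-toList-beyond (tabulate F) 0
                            | coeff-++-beyond ĝ-low (1 ∷ []) 0 = ≡⇒≡ₘ (sym (*-identityʳ t))
    ... | beyond (suc k) rewrite coeff-++-beyond s (t ∷ []) (suc k) | coeff-toList-beyond (tabulate F) (suc k)
                               | coeff-ĝ-beyond k = ≡⇒≡ₘ (sym (*-zeroʳ t))

  ⟦addConst⟧ : ∀ a (e : Elem) → ⟦ addConst a e ⟧ ≈ₚ addP (a ∷ []) ⟦ e ⟧
  ⟦addConst⟧ a (b ∷ bs) = ∷-congₘ (+p≡ₘ+ a b) (by-coeff λ n → refl)

  open ModuloPrincipalIdeal ℤ/p[x] ĝ public using (_∼_; congruent; ≈⇒∼; multiple∼0; quotientRing)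
  module Q = CommutativeRing quotientRing

  X : List ℕ
  X = 0 ∷ 1 ∷ []

  0∷≈X* : ∀ f → (0 ∷ f) ≈ₚ mulP X f
  0∷≈X* f = ≐⇒≈ₚ λ n → sym (trans (coeff-mulP-∷ˡ 0 (1 ∷ []) f n) (∷-cong≐ (mulP-identityˡ f) n))

  ∷≈constant+X* : ∀ a f → (a ∷ f) ≈ₚ addP (a ∷ []) (mulP X f)
  ∷≈constant+X* a f = Pol.trans (∷-congₘ (≡⇒≡ₘ (sym (+-identityʳ a))) (Pol.refl {f})) (Pol.+-congˡ {a ∷ []} (0∷≈X* f))

  mulX-correct∼ : ∀ r → (0 ∷ ⟦ r ⟧) ∼ ⟦ mulX r ⟧
  mulX-correct∼ r with mulX-correct r
  ... | t , 0∷r≈ = congruent (t ∷ []) (Pol.trans 0∷r≈ (Pol.+-congˡ {⟦ mulX r ⟧} (≐⇒≈ₚ {scale t ĝ} {mulP (t ∷ []) ĝ} (scale≐constant* t ĝ))))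

  reduce-correct : ∀ f → f ∼ ⟦ reduce f ⟧
  reduce-correct [] = ≈⇒∼ (Pol.sym ⟦zeroQ⟧)
  reduce-correct (a ∷ f) = begin
    a ∷ f                                    ≈⟨ ≈⇒∼ (∷≈constant+X* a f) ⟩
    addP (a ∷ []) (mulP X f)                 ≈⟨ Q.+-congˡ {a ∷ []} (Q.*-congˡ {X} (reduce-correct f)) ⟩
    addP (a ∷ []) (mulP X ⟦ r ⟧)             ≈⟨ ≈⇒∼ (Pol.+-congˡ {a ∷ []} (Pol.sym (0∷≈X* ⟦ r ⟧))) ⟩
    addP (a ∷ []) (0 ∷ ⟦ r ⟧)                ≈⟨ Q.+-congˡ {a ∷ []} (mulX-correct∼ r) ⟩
    addP (a ∷ []) ⟦ mulX r ⟧                 ≈⟨ ≈⇒∼ (Pol.sym (⟦addConst⟧ a (mulX r))) ⟩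
    ⟦ reduce (a ∷ f) ⟧                       ∎
    where
    open import Relation.Binary.Reasoning.Setoid Q.setoid
    r : Elem
    r = reduce f

  open Pullback quotientRing (λ (a : Elem) → ⟦ a ⟧) _+q_ _*q_ -q_ zeroQ oneQ public
    using (_≈ᴱ_; by-ι; ι-≈)

  𝔽 : CommutativeRing 0ℓ 0ℓ
  𝔽 = Pullback.pullbackRing quotientRing (λ (a : Elem) → ⟦ a ⟧) _+q_ _*q_ -q_ zeroQ oneQ
        (λ a b → ≈⇒∼ (⟦+q⟧ a b)) (λ a b → Q.sym (reduce-correct (mulP ⟦ a ⟧ ⟦ b ⟧)))
        (λ a → ≈⇒∼ (⟦-q⟧ a)) (≈⇒∼ ⟦zeroQ⟧) (≈⇒∼ ⟦oneQ⟧)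

  coeff-ĝ-above : ∀ m → h < m → coeff ĝ m ≡ 0
  coeff-ĝ-above m h<m = subst (λ i → coeff ĝ i ≡ 0) (trans (+-suc h (m ∸ suc h)) (m+[n∸m]≡n h<m))
                              (coeff-ĝ-beyond (m ∸ suc h))

  degree[Dĝ]<h⇒D≈0 : ∀ D → DegreeBelow h (mulP D ĝ) → D ≈ₚ []
  degree[Dĝ]<h⇒D≈0 [] _ = Pol.refl
  degree[Dĝ]<h⇒D≈0 (a ∷ D) degree<h = by-coeff λ { zero → a≡ₘ0 ; (suc n) → coeff-≡ₘ D≈0 n }
    where
    Dĝ-degree<h : DegreeBelow h (mulP D ĝ)
    Dĝ-degree<h m h≤m = trans (≡⇒≡ₘ (sym shift)) (degree<h (suc m) (m≤n⇒m≤1+n h≤m))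
      where
      shift : coeff (mulP (a ∷ D) ĝ) (suc m) ≡ coeff (mulP D ĝ) m
      shift = trans (coeff-mulP-∷ˡ a D ĝ (suc m))
                (cong (_+ coeff (mulP D ĝ) m) (trans (cong (a *_) (coeff-ĝ-above (suc m) (s≤s h≤m))) (*-zeroʳ a)))
    D≈0 : D ≈ₚ []
    D≈0 = degree[Dĝ]<h⇒D≈0 D Dĝ-degree<h
    a≡ₘ0 : a ≡ₘ 0
    a≡ₘ0 = begin
      a % p                                          ≡⟨ cong (_% p) (trans (+-identityʳ (a * 1)) (*-identityʳ a)) ⟨
      (a * 1 + 0) % p                                ≡⟨ +-congₘ {a * 1} refl (sym (coeff-≡ₘ (mulP-congₘ D≈0 (Pol.refl {ĝ})) h')) ⟩
      (a * 1 + coeff (mulP D ĝ) h') % p              ≡⟨ cong (λ c → (a * c + coeff (mulP D ĝ) h') % p) coeff-ĝ-h ⟨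
      (a * coeff ĝ h + coeff (0 ∷ mulP D ĝ) h) % p   ≡⟨ cong (_% p) (coeff-mulP-∷ˡ a D ĝ h) ⟨
      coeff (mulP (a ∷ D) ĝ) h % p                   ≡⟨ degree<h h ≤-refl ⟩
      0 % p                                          ∎
      where open ≡-Reasoning

  ∼⇒≈ₚ : ∀ {F F'} → DegreeBelow h F → DegreeBelow h F' → F ∼ F' → F ≈ₚ F'
  ∼⇒≈ₚ {F} {F'} F<h F'<h (congruent Q F≈F'+Qĝ) =
    Pol.trans F≈F'+Qĝ (Pol.trans (Pol.+-congˡ {F'} Qĝ≈0) (Pol.+-identityʳ F'))
    where
    Qĝ-degree<h : DegreeBelow h (mulP Q ĝ)
    Qĝ-degree<h m h≤m = begin
      coeff (mulP Q ĝ) m % p                  ≡⟨ +-congₘ (F'<h m h≤m) refl ⟨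
      (coeff F' m + coeff (mulP Q ĝ) m) % p   ≡⟨ ≡⇒≡ₘ (coeff-addP F' (mulP Q ĝ) m) ⟨
      coeff (addP F' (mulP Q ĝ)) m % p        ≡⟨ coeff-≡ₘ F≈F'+Qĝ m ⟨
      coeff F m % p                           ≡⟨ F<h m h≤m ⟩
      0 % p                                   ∎
      where open ≡-Reasoning
    Qĝ≈0 : mulP Q ĝ ≈ₚ []
    Qĝ≈0 = mulP-congₘ (degree[Dĝ]<h⇒D≈0 Q Qĝ-degree<h) (Pol.refl {ĝ})


module FieldStructure (p : ℕ) .{{_ : NonZero p}} (prime : Prime p) (h' : ℕ) (g : Vec ℕ (suc (suc h')))
  (g_h≢0 : ¬ Residues._≡ₘ_ p (lookup g (fromℕ (suc h'))) 0) (irreducible : Fp.Irreducible p (toList g)) where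

  open import Data.Nat
  open import Data.Nat.Properties
  open import Data.Nat.Induction using (<-rec)
  open import Data.Fin using (zero; suc; toℕ; inject₁)
  open import Data.Fin.Properties using (toℕ-inject₁; toℕ-fromℕ)
  open import Data.List using (List; []; _∷_; length)
  open import Data.Product using (Σ; _×_; _,_; proj₂)
  open import Data.Sum using (_⊎_; inj₁; inj₂)
  open import Data.Empty using (⊥; ⊥-elim)
  open import Relation.Binary.PropositionalEquality
  open import Relation.Nullary using (Dec; yes; no)
  open Fp p using (normP; addP; mulP)
  open GF p g using (Elem; lcInv; zeroQ; _*q_)
  open Residues p
  open Polynomials p
  open Representation p h' g
  open IntegralDomain ℤ/p using (x*y≈0∧y≉0⇒x≈0)

  g_h : ℕ
  g_h = lookup g (fromℕ h)

  g≈g_hĝ : toList g ≈ₚ scale g_h ĝ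
  g≈g_hĝ = by-coeff coeff≡ₘ
    where
    g_hλ≡ₘ1 : g_h * lcInv ≡ₘ 1
    g_hλ≡ₘ1 = trans (*-congₘ {g_h} refl (a%p≡ₘa _)) (fermat-inverse prime g_h g_h≢0)
    coeff≡ₘ : ∀ m → coeff (toList g) m ≡ₘ coeff (scale g_h ĝ) m
    coeff≡ₘ m rewrite coeff-scale g_h ĝ m with indexView h m
    ... | inside i = begin
      coeff (toList g) (toℕ i)                  ≡⟨ cong (coeff (toList g)) (toℕ-inject₁ i) ⟨
      coeff (toList g) (toℕ (inject₁ i))        ≡⟨ coeff-toList-inside g (inject₁ i) ⟩
      lookup g (inject₁ i)                      ≈⟨ ℤp.*-identityˡ _ ⟨
      1 * lookup g (inject₁ i)                  ≈⟨ *-congₘ {b = lookup g (inject₁ i)} g_hλ≡ₘ1 refl ⟨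
      (g_h * lcInv) * lookup g (inject₁ i)      ≡⟨ *-assoc g_h lcInv _ ⟩
      g_h * ĝ-coeff i                           ≡⟨ cong (g_h *_) (coeff-ĝ-inside i) ⟨
      g_h * coeff ĝ (toℕ i)                     ∎
      where open import Relation.Binary.Reasoning.Setoid ℤp.setoid
    ... | beyond zero = ≡⇒≡ₘ (begin
      coeff (toList g) (h + 0)                  ≡⟨ cong (coeff (toList g)) (trans (+-identityʳ h) (sym (toℕ-fromℕ h))) ⟩
      coeff (toList g) (toℕ (fromℕ h))          ≡⟨ coeff-toList-inside g (fromℕ h) ⟩
      g_h                                       ≡⟨ *-identityʳ g_h ⟨
      g_h * 1                                   ≡⟨ cong (g_h *_) (coeff-++-beyond ĝ-low (1 ∷ []) 0) ⟨
      g_h * coeff ĝ (h + 0)                     ∎)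
      where open ≡-Reasoning
    ... | beyond (suc k) = ≡⇒≡ₘ (begin
      coeff (toList g) (h + suc k)              ≡⟨ cong (coeff (toList g)) (+-suc h k) ⟩
      coeff (toList g) (suc h + k)              ≡⟨ coeff-toList-beyond g k ⟩
      0                                         ≡⟨ *-zeroʳ g_h ⟨
      g_h * 0                                   ≡⟨ cong (g_h *_) (coeff-ĝ-beyond k) ⟨
      g_h * coeff ĝ (h + suc k)                 ∎)
      where open ≡-Reasoning

  ĝ≉S*A : ∀ S A d → Degree d A → 1 ≤ d → d < h → ¬ ĝ ≈ₚ mulP S A
  ĝ≉S*A S A d (A<1+d , A_d≢0) 1≤d d<h ĝ≈SA =
    proj₂ irreducible (scale g_h S) A g_hS-nonconstant A-nonconstant factorisation
    where
    factorisation : normP (mulP (scale g_h S) A) ≡ normP (toList g)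
    factorisation = normP-cong (begin
      mulP (scale g_h S) A      ≈⟨ ≐⇒≈ₚ (mulP-comm (scale g_h S) A) ⟩
      mulP A (scale g_h S)      ≈⟨ ≐⇒≈ₚ (mulP-scaleʳ A g_h S) ⟩
      scale g_h (mulP A S)      ≈⟨ scale-congₘ {g_h} refl (≐⇒≈ₚ (mulP-comm A S)) ⟩
      scale g_h (mulP S A)      ≈⟨ scale-congₘ {g_h} refl ĝ≈SA ⟨
      scale g_h ĝ               ≈⟨ g≈g_hĝ ⟨
      toList g                  ∎)
      where open import Relation.Binary.Reasoning.Setoid Pol.setoid
    A-nonconstant : 2 ≤ length (normP A)
    A-nonconstant = 2≤length-normP A (λ A-constant → A_d≢0 (A-constant d 1≤d))
    -- A constant g_h S forces S = s₀ constant, and then ĝ = s₀ A vanishes at degree h > d.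
    g_hS-nonconstant : 2 ≤ length (normP (scale g_h S))
    g_hS-nonconstant = 2≤length-normP (scale g_h S) λ g_hS-constant → 1≢ₘ0 prime (begin
      1                                ≡⟨ coeff-ĝ-h ⟨
      coeff ĝ h                        ≈⟨ coeff-≡ₘ ĝ≈SA h ⟩
      coeff (mulP S A) h               ≈⟨ coeff-≡ₘ (mulP-congₘ (S≈s₀ g_hS-constant) (Pol.refl {A})) h ⟩
      coeff (mulP (s₀ ∷ []) A) h       ≡⟨ scale≐constant* s₀ A h ⟨
      coeff (scale s₀ A) h             ≡⟨ coeff-scale s₀ A h ⟩
      s₀ * coeff A h                   ≈⟨ *-congₘ {s₀} refl (A<1+d h d<h) ⟩
      s₀ * 0                           ≡⟨ *-zeroʳ s₀ ⟩
      0                                ∎)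
      where
      open import Relation.Binary.Reasoning.Setoid ℤp.setoid
      s₀ : ℕ
      s₀ = coeff S 0
      S≈s₀ : (∀ m → 1 ≤ m → coeff (scale g_h S) m ≡ₘ 0) → S ≈ₚ (s₀ ∷ [])
      S≈s₀ g_hS-constant = by-coeff λ
        { zero → refl
        ; (suc m) → x*y≈0∧y≉0⇒x≈0 (ℤ/p-noZeroDivisors prime)
                      (trans (≡⇒≡ₘ (trans (*-comm (coeff S (suc m)) g_h) (sym (coeff-scale g_h S (suc m)))))
                             (g_hS-constant (suc m) (s≤s z≤n))) g_h≢0 }

  ĝ∼0 : ĝ ∼ []
  ĝ∼0 = Q.trans (≈⇒∼ (Pol.sym (≐⇒≈ₚ (mulP-identityˡ ĝ)))) (multiple∼0 (1 ∷ []))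

  record ZeroDivisorOfDegree (d : ℕ) : Set where
    constructor zeroDivisor
    field
      A B : List ℕ
      A-degree : Degree d A
      B-degree : DegreeBelow h B
      B≉0 : ¬ B ≈ₚ []
      AB∼0 : mulP A B ∼ []

  -- Euclid's algorithm on ĝ and A: the remainder R of ĝ by A annihilates B as well and has smaller degree,
  -- while R = 0 would make A a proper factor of ĝ.
  no-zeroDivisor-of-degree : ∀ d → d < h → ¬ ZeroDivisorOfDegree d
  no-zeroDivisor-of-degree = <-rec (λ d → d < h → ¬ ZeroDivisorOfDegree d) descent
    where
    descent : ∀ d → (∀ {d'} → d' < d → d' < h → ¬ ZeroDivisorOfDegree d') → d < h → ¬ ZeroDivisorOfDegree d
    descent zero _ _ (zeroDivisor A B (A<1 , A₀≢0) B<h B≉0 AB∼0) = B≉0 (∼⇒≈ₚ B<h (λ _ _ → refl) B∼0)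
      where
      open import Relation.Binary.Reasoning.Setoid Q.setoid
      c v : ℕ
      c = coeff A 0
      v = c ^ (p ∸ 2)
      A≈c : A ≈ₚ (c ∷ [])
      A≈c = by-coeff λ { zero → refl ; (suc m) → A<1 (suc m) (s≤s z≤n) }
      vA≈1 : mulP (v ∷ []) A ≈ₚ (1 ∷ [])
      vA≈1 = Pol.trans (Pol.*-congˡ {v ∷ []} A≈c) (by-coeff λ
        { zero → trans (≡⇒≡ₘ (trans (+-identityʳ (v * c)) (*-comm v c))) (fermat-inverse prime c A₀≢0)
        ; (suc m) → refl })
      B∼0 : B ∼ []
      B∼0 = begin
        B                                ≈⟨ ≈⇒∼ (≐⇒≈ₚ (mulP-identityˡ B)) ⟨
        mulP (1 ∷ []) B                  ≈⟨ ≈⇒∼ (Pol.*-congʳ vA≈1) ⟨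
        mulP (mulP (v ∷ []) A) B         ≈⟨ ≈⇒∼ (Pol.*-assoc (v ∷ []) A B) ⟩
        mulP (v ∷ []) (mulP A B)         ≈⟨ Q.*-congˡ {v ∷ []} AB∼0 ⟩
        mulP (v ∷ []) []                 ≈⟨ Q.zeroʳ (v ∷ []) ⟩
        []                               ∎
    descent (suc d) smaller d<h (zeroDivisor A B degA B<h B≉0 AB∼0)
      with divide prime degA (suc h) ĝ (λ m h<m → ≡⇒≡ₘ (coeff-ĝ-above m h<m))
    ... | division S R ĝ≈SA+R R<1+d with zero-or-degree (suc d) R R<1+d
    ...   | inj₁ R≈0 = ĝ≉S*A S A (suc d) degA (s≤s z≤n) d<h
                         (Pol.trans ĝ≈SA+R (Pol.trans (Pol.+-congˡ {mulP S A} R≈0) (Pol.+-identityʳ (mulP S A))))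
    ...   | inj₂ (d' , d'<1+d , degR) = smaller d'<1+d (<-trans d'<1+d d<h) (zeroDivisor R B degR B<h B≉0 RB∼0)
      where
      open import Relation.Binary.Reasoning.Setoid Q.setoid
      open import Algebra.Properties.Ring Q.ring using (-‿distribˡ-*)
      open import Algebra.Properties.Group Q.+-group using (inverseʳ-unique; ε⁻¹≈ε)
      R∼-SA : R ∼ Q.- mulP S A
      R∼-SA = inverseʳ-unique (mulP S A) R (Q.trans (≈⇒∼ (Pol.sym ĝ≈SA+R)) ĝ∼0)
      RB∼0 : mulP R B ∼ []
      RB∼0 = begin
        mulP R B                          ≈⟨ Q.*-congʳ R∼-SA ⟩
        mulP (Q.- mulP S A) B             ≈⟨ -‿distribˡ-* (mulP S A) B ⟨
        Q.- mulP (mulP S A) B             ≈⟨ Q.-‿cong (Q.*-assoc S A B) ⟩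
        Q.- mulP S (mulP A B)             ≈⟨ Q.-‿cong (Q.*-congˡ {S} AB∼0) ⟩
        Q.- mulP S []                     ≈⟨ Q.-‿cong (Q.zeroʳ S) ⟩
        Q.- []                            ≈⟨ ε⁻¹≈ε ⟩
        []                                ∎

  𝔽-noZeroDivisors : IntegralDomain.NoZeroDivisors 𝔽
  𝔽-noZeroDivisors a b ab≈0 = cases (toList≈[]? a) (toList≈[]? b)
    where
    cases : Dec (⟦ a ⟧ ≈ₚ []) → Dec (⟦ b ⟧ ≈ₚ []) → a ≈ᴱ zeroQ ⊎ b ≈ᴱ zeroQ
    cases (yes a≈0) _ = inj₁ (by-ι (≈⇒∼ (Pol.trans a≈0 (Pol.sym ⟦zeroQ⟧))))
    cases (no _) (yes b≈0) = inj₂ (by-ι (≈⇒∼ (Pol.trans b≈0 (Pol.sym ⟦zeroQ⟧))))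
    cases (no a≉0) (no b≉0) = ⊥-elim (degree-cases (zero-or-degree h ⟦ a ⟧ (toList-degreeBelow a)))
      where
      ab∼0 : mulP ⟦ a ⟧ ⟦ b ⟧ ∼ []
      ab∼0 = Q.trans (reduce-correct (mulP ⟦ a ⟧ ⟦ b ⟧)) (Q.trans (ι-≈ ab≈0) (≈⇒∼ ⟦zeroQ⟧))
      degree-cases : ⟦ a ⟧ ≈ₚ [] ⊎ Σ ℕ (λ d → d < h × Degree d ⟦ a ⟧) → ⊥
      degree-cases (inj₁ a≈0) = a≉0 a≈0
      degree-cases (inj₂ (d , d<h , degA)) =
        no-zeroDivisor-of-degree d d<h (zeroDivisor ⟦ a ⟧ ⟦ b ⟧ degA (toList-degreeBelow b) b≉0 ab∼0)


-- GF.digits does not depend on g; the module takes g only to be able to name it.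
module Digits (p : ℕ) .{{_ : NonZero p}} {h : ℕ} (g : Vec ℕ (suc h)) where

  open import Data.Nat
  open import Data.Nat.Properties
  open import Data.Nat.DivMod
  open import Data.List using ([])
  open import Relation.Binary.PropositionalEquality
  open GF p g using (digits)
  open Residues p
  open Polynomials p

  digits-injective : ∀ m {n n'} → n < p ^ m → n' < p ^ m → toList (digits m n) ≈ₚ toList (digits m n') → n ≡ n'
  digits-injective zero {zero} {zero} _ _ _ = refl
  digits-injective zero {suc n} (s≤s ()) _ _
  digits-injective zero {zero} {suc n'} _ (s≤s ()) _
  digits-injective (suc m) {n} {n'} n<pᵐ⁺¹ n'<pᵐ⁺¹ digits≈ = begin
    n                      ≡⟨ m≡m%n+[m/n]*n n p ⟩
    n % p + (n / p) * p    ≡⟨ cong₂ (λ r q → r + q * p) low≡ high≡ ⟩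
    n' % p + (n' / p) * p  ≡⟨ m≡m%n+[m/n]*n n' p ⟨
    n'                     ∎
    where
    open ≡-Reasoning
    low≡ : n % p ≡ n' % p
    low≡ = trans (sym (m%n%n≡m%n n p)) (trans (coeff-≡ₘ digits≈ 0) (m%n%n≡m%n n' p))
    quotient< : ∀ {x} → x < p ^ suc m → x / p < p ^ m
    quotient< {x} x< = m<n*o⇒m/o<n (subst (x <_) (*-comm p (p ^ m)) x<)
    high≡ : n / p ≡ n' / p
    high≡ = digits-injective m (quotient< n<pᵐ⁺¹) (quotient< n'<pᵐ⁺¹) (by-coeff λ i → coeff-≡ₘ digits≈ (suc i))

  digits-zero : ∀ m → toList (digits m 0) ≈ₚ []
  digits-zero zero = by-coeff λ i → refl
  digits-zero (suc m) = by-coeff λ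
    { zero → a%p≡ₘa 0
    ; (suc i) → coeff-≡ₘ (subst (λ z → toList (digits m z) ≈ₚ []) (sym (m<n⇒m/n≡0 (>-nonZero⁻¹ p))) (digits-zero m)) i }


module PascalColumns (p : ℕ) .{{_ : NonZero p}} (prime : Prime p) (h' : ℕ) (g : Vec ℕ (suc (suc h')))
  (g<p : All (_< p) g) (g_h≢0 : lookup g (fromℕ (suc h')) ≢ 0) (irreducible : Fp.Irreducible p (toList g)) where

  open import Data.Nat
  open import Data.Nat.Properties
  open import Data.Fin using (toℕ; zero; suc)
  open import Data.Fin.Properties using (toℕ-injective; toℕ<n)
  open import Data.List using ([])
  open import Data.Vec as V using ([]; _∷_)
  open import Data.Vec.Relation.Unary.All using ([]; _∷_)
  open import Data.Vec.Relation.Unary.All.Properties using (lookup⁺)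
  open import Relation.Binary.PropositionalEquality
  open GF p g
  open Residues p
  open Polynomials p
  open Representation p h' g

  g_h≢ₘ0 : ¬ lookup g (fromℕ h) ≡ₘ 0
  g_h≢ₘ0 g_h≡ₘ0 = g_h≢0 (<p∧≡ₘ0⇒≡0 (lookup⁺ g<p (fromℕ h)) g_h≡ₘ0)

  open FieldStructure p prime h' g g_h≢ₘ0 irreducible
  open Digits p g
  module F = CommutativeRing 𝔽
  open IntegralDomain 𝔽 using (x≉0⇒x^n≉0)
  open NewtonBasis 𝔽 using (NewtonColumns; newton-independent)
  open import Algebra.Properties.Semiring.Sum F.semiring using (sum)
  open import Algebra.Properties.Semiring.Exp F.semiring using () renaming (_^_ to _^ᴿ_)

  ≈ᴱ⇒≈ₚ : ∀ {a b : Elem} → a ≈ᴱ b → ⟦ a ⟧ ≈ₚ ⟦ b ⟧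
  ≈ᴱ⇒≈ₚ {a} {b} a≈b = ∼⇒≈ₚ (toList-degreeBelow a) (toList-degreeBelow b) (ι-≈ a≈b)

  reduced≈ₚ[]⇒≡replicate : ∀ {n} (v : Vec ℕ n) → All (_< p) v → ⟦ v ⟧ ≈ₚ [] → v ≡ V.replicate n 0
  reduced≈ₚ[]⇒≡replicate [] [] _ = refl
  reduced≈ₚ[]⇒≡replicate (x ∷ v) (x<p ∷ v<p) x∷v≈0 =
    cong₂ _∷_ (<p∧≡ₘ0⇒≡0 x<p (coeff-≡ₘ x∷v≈0 0))
              (reduced≈ₚ[]⇒≡replicate v v<p (by-coeff λ i → coeff-≡ₘ x∷v≈0 (suc i)))

  oneQ≉zeroQ : ¬ oneQ ≈ᴱ zeroQ
  oneQ≉zeroQ 1≈0 = 1≢ₘ0 prime (coeff-≡ₘ (Pol.trans (Pol.sym ⟦oneQ⟧) (Pol.trans (≈ᴱ⇒≈ₚ 1≈0) ⟦zeroQ⟧)) 0)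

  σ-injective : ∀ {n n'} → n < p ^ h → n' < p ^ h → σ n ≈ᴱ σ n' → n ≡ n'
  σ-injective n<q n'<q σn≈σn' = digits-injective h n<q n'<q (≈ᴱ⇒≈ₚ σn≈σn')

  σ≉0 : ∀ {n} → 0 < n → n < p ^ h → ¬ σ n ≈ᴱ zeroQ
  σ≉0 {suc n} _ 1+n<q σ≈0 = 1+n≢0 (digits-injective h 1+n<q (m^n>0 p h)
    (Pol.trans (≈ᴱ⇒≈ₚ σ≈0) (Pol.trans ⟦zeroQ⟧ (Pol.sym (digits-zero h)))))

  ^q≡^ᴿ : ∀ x n → x ^q n ≡ x ^ᴿ n
  ^q≡^ᴿ x zero = refl
  ^q≡^ᴿ x (suc n) = cong (x *q_) (^q≡^ᴿ x n)

  u : ℕ → Elem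
  u m = invq (σ (suc m))

  u≉0 : ∀ m → suc m < p ^ h → ¬ u m ≈ᴱ zeroQ
  u≉0 m 1+m<q = subst (λ y → ¬ y ≈ᴱ zeroQ) (sym (^q≡^ᴿ (σ (suc m)) (p ^ h ∸ 2)))
    (x≉0⇒x^n≉0 𝔽-noZeroDivisors oneQ≉zeroQ (p ^ h ∸ 2) (σ≉0 (s≤s z≤n) 1+m<q))

  sumQ≡sum : ∀ {k} (v : Fin k → Elem) → sumQ v ≡ sum v
  sumQ≡sum {zero} v = refl
  sumQ≡sum {suc k} v = cong (v zero +q_) (sumQ≡sum (λ j → v (suc j)))

  columns-independent : ∀ k → k ≤ p ^ h → (c : Fin k → Fin (p ^ h)) → Injective _≡_ _≡_ c →
    (a : Fin k → Elem) → (∀ j → All (_< p) (a j)) →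
    (∀ m → m < k → sumQ (λ j → a j *q P m (toℕ (c j))) ≡ zeroQ) →
    ∀ j → a j ≡ zeroQ
  columns-independent k k≤q c c-injective a a<p rows≡0 j =
    reduced≈ₚ[]⇒≡replicate (a j) (a<p j) (Pol.trans (≈ᴱ⇒≈ₚ (a≈0 j)) ⟦zeroQ⟧)
    where
    pascal : NewtonColumns σ u k
    pascal = record
      { node = λ j → σ (toℕ (c j))
      ; column = λ m j → f m (toℕ (c j))
      ; column-zero = λ j → F.refl
      ; column-suc = λ m j → F.refl }
    node-injective : Injective _≡_ _≈ᴱ_ (NewtonColumns.node pascal)
    node-injective {i} {j} σcᵢ≈σcⱼ = c-injective (toℕ-injective (σ-injective (toℕ<n (c i)) (toℕ<n (c j)) σcᵢ≈σcⱼ))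
    a≈0 : ∀ j → a j ≈ᴱ zeroQ
    a≈0 = newton-independent σ u 𝔽-noZeroDivisors pascal node-injective (λ m 1+m<k → u≉0 m (≤-trans 1+m<k k≤q)) a
            (λ m m<k → F.reflexive (trans (sym (sumQ≡sum (λ j → a j *q f m (toℕ (c j))))) (rows≡0 m m<k)))


lemma1 : (p h : ℕ) .{{_ : NonZero p}} → Prime p → 1 ≤ h →
    (g : Vec ℕ (suc h)) → All (_< p) g → lookup g (fromℕ h) ≢ 0 →
    Fp.Irreducible p (toList g) →
    (k : ℕ) → 1 ≤ k → k ≤ p ^ h →
    (c : Fin k → Fin (p ^ h)) → Injective _≡_ _≡_ c →
    (a : Fin k → GF.Elem p g) → (∀ j → All (_< p) (a j)) →
    (∀ (m : ℕ) → m < k →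
       GF.sumQ p g (λ j → GF._*q_ p g (a j) (GF.P p g m (Data.Fin.toℕ (c j))))
         ≡ GF.zeroQ p g) →
    ∀ j → a j ≡ GF.zeroQ p g
lemma1 p (suc h') p-prime (s≤s z≤n) g g<p g_h≢0 irreducible k _ =
  PascalColumns.columns-independent p p-prime h' g g<p g_h≢0 irreducible k
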